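{- For each constant $c:\sigma$ of $\mathsf{HA}^\omega$ (at each type instance) there is a closed $\mathsf{HA}^\omega$-term $c^\alpha:\sigma^+$ with $\mathsf{HA}^\omega\vdash\mathrm{dom}_\sigma(c^\alpha)$, such that the defining equations of the constants hold with respect to $*$, provably in $\mathsf{HA}^\omega$: $\mathsf{k}^\alpha*x*y\equiv x$; $\mathsf{s}^\alpha*x*y*z\equiv x*z*(y*z)$; $\mathsf{fst}^\alpha*(\mathsf{pair}^\alpha*x*y)\equiv x$; $\mathsf{snd}^\alpha*(\mathsf{pair}^\alpha*x*y)\equiv y$; $\mathsf{R}^\alpha*x*y*0^\alpha\equiv x$; $\mathsf{R}^\alpha*x*y*(S^\alpha*m)\equiv y*m*(\mathsf{R}^\alpha*x*y*m)$ (for variables of the appropriate types $(\cdot)^+$).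
   Context: Finite types are generated by: $0$ is a type; if $\sigma,\tau$ are types, so are $\sigma\times\tau$ and $\sigma\to\tau$ ($\to$ associates to the right). $\mathsf{HA}^\omega$ is the many-sorted intuitionistic first-order theory whose sorts are the finite types. Its terms are built from variables and, for all types $\rho,\sigma,\tau$, the constants $\mathsf{k}:\rho\to\sigma\to\rho$, $\mathsf{s}:(\rho\to\sigma\to\tau)\to(\rho\to\sigma)\to(\rho\to\tau)$, $\mathsf{pair}:\sigma\to\tau\to\sigma\times\tau$, $\mathsf{fst}:\sigma\times\tau\to\sigma$, $\mathsf{snd}:\sigma\times\tau\to\tau$, $0:0$, $S:0\to0$, $\mathsf{R}:\sigma\to(0\to\sigma\to\sigma)\to0\to\sigma$, by application (associating to the left). Atomic formulas are $\bot$ and $s\equiv_\sigma t$; $\neg\varphi$ abbreviates $\varphi\to\bot$. Axioms: $\equiv_\sigma$ is an equivalence relation; $x\equiv x'\to y\equiv y'\to xy\equiv x'y'$; $\mathsf{k}xy\equiv x$; $\mathsf{s}xyz\equiv xz(yz)$; $\mathsf{fst}(\mathsf{pair}\,xy)\equiv x$; $\mathsf{snd}(\mathsf{pair}\,xy)\equiv y$; $\mathsf{R}xy0\equiv x$; $\mathsf{R}xy(Sm)\equiv ym(\mathsf{R}xym)$; $Sx\equiv_0Sy\to x\equiv_0y$; $\neg(Sx\equiv_00)$; induction for all formulas. Surjective pairing is not assumed. Auxiliary types and formulas (by induction on $\sigma$): $0^+:=0$, $0^-:=0$, $\mathrm{dom}_0(x):=\top$, $\mathrm{app}_0(x,y,z):=\neg(x\equiv_0y)$.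 $(\sigma\times\tau)^+:=\sigma^+\times\tau^+$, $(\sigma\times\tau)^-:=(\sigma^-\times\tau^-)\times0$, $\mathrm{dom}_{\sigma\times\tau}(x):=\mathrm{dom}_\sigma(\mathsf{fst}\,x)\wedge\mathrm{dom}_\tau(\mathsf{snd}\,x)$, $\mathrm{app}_{\sigma\times\tau}(x,y,z):=(\mathsf{snd}\,z\equiv_00\to\mathrm{app}_\sigma(\mathsf{fst}\,x,\mathsf{fst}\,y,\mathsf{fst}(\mathsf{fst}\,z)))\wedge(\neg(\mathsf{snd}\,z\equiv_00)\to\mathrm{app}_\tau(\mathsf{snd}\,x,\mathsf{snd}\,y,\mathsf{snd}(\mathsf{fst}\,z)))$. $(\sigma\to\tau)^+:=(\sigma^+\to\tau^+)\times(\sigma^+\to\sigma^+\to\tau^-\to\sigma^-)$, $(\sigma\to\tau)^-:=\sigma^+\times\tau^-$; for $s:(\sigma\to\tau)^+$, $t:\sigma^+$ write $s*t:=(\mathsf{fst}\,s)t:\tau^+$ ($*$ associates to the left); $\mathrm{dom}_{\sigma\to\tau}(x):=\forall u:\sigma^+(\mathrm{dom}_\sigma(u)\to\mathrm{dom}_\tau(x*u))\wedge\forall u,v:\sigma^+\forall w:\tau^-(\mathrm{dom}_\sigma(u)\to\mathrm{dom}_\sigma(v)\to\mathrm{app}_\tau(x*u,x*v,w)\to\mathrm{app}_\sigma(u,v,(\mathsf{snd}\,x)uvw))$; $\mathrm{app}_{\sigma\to\tau}(x,y,z):=\mathrm{dom}_\sigma(\mathsf{fst}\,z)\wedge\mathrm{app}_\tau(x*(\mathsf{fst}\,z),y*(\mathsf{fst}\,z),\mathsf{snd}\,z)$.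 -}

module Defs where

open import Data.List using (List; []; _∷_; map)
open import Data.List.Membership.Propositional using (_∈_)

infixr 7 _⊗_
infixr 6 _⇒_
data Ty : Set where
  ι   : Ty               -- the base type 0
  _⊗_ : Ty → Ty → Ty
  _⇒_ : Ty → Ty → Ty

data Const : Ty → Set where
  k    : ∀ ρ σ → Const (ρ ⇒ σ ⇒ ρ)
  s    : ∀ ρ σ τ → Const ((ρ ⇒ σ ⇒ τ) ⇒ (ρ ⇒ σ) ⇒ (ρ ⇒ τ))
  pair : ∀ σ τ → Const (σ ⇒ τ ⇒ σ ⊗ τ)
  fst  : ∀ σ τ → Const (σ ⊗ τ ⇒ σ)
  snd  : ∀ σ τ → Const (σ ⊗ τ ⇒ τ)
  zero : Const ι
  suc  : Const (ι ⇒ ι)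
  rec  : ∀ σ → Const (σ ⇒ (ι ⇒ σ ⇒ σ) ⇒ ι ⇒ σ)

Ctx : Set
Ctx = List Ty

data Var : Ctx → Ty → Set where
  vz : ∀ {Γ σ} → Var (σ ∷ Γ) σ
  vs : ∀ {Γ σ τ} → Var Γ σ → Var (τ ∷ Γ) σ

infixl 9 _·_
data Tm (Γ : Ctx) : Ty → Set where
  var : ∀ {σ} → Var Γ σ → Tm Γ σ
  con : ∀ {σ} → Const σ → Tm Γ σ
  _·_ : ∀ {σ τ} → Tm Γ (σ ⇒ τ) → Tm Γ σ → Tm Γ τ

Ren : Ctx → Ctx → Set
Ren Γ Δ = ∀ {σ} → Var Γ σ → Var Δ σ

liftR : ∀ {Γ Δ τ} → Ren Γ Δ → Ren (τ ∷ Γ) (τ ∷ Δ)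
liftR ρ vz     = vz
liftR ρ (vs v) = vs (ρ v)

renT : ∀ {Γ Δ σ} → Ren Γ Δ → Tm Γ σ → Tm Δ σ
renT ρ (var v) = var (ρ v)
renT ρ (con c) = con c
renT ρ (t · u) = renT ρ t · renT ρ u

wkT : ∀ {Γ σ τ} → Tm Γ σ → Tm (τ ∷ Γ) σ
wkT = renT vs

closedRen : ∀ {Γ} → Ren [] Γ
closedRen ()

emb : ∀ {Γ σ} → Tm [] σ → Tm Γ σ
emb = renT closedRen

Sub : Ctx → Ctx → Set
Sub Γ Δ = ∀ {σ} → Var Γ σ → Tm Δ σ

liftS : ∀ {Γ Δ τ} → Sub Γ Δ → Sub (τ ∷ Γ) (τ ∷ Δ)
liftS θ vz     = var vz
liftS θ (vs v) = wkT (θ v)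

subT : ∀ {Γ Δ σ} → Sub Γ Δ → Tm Γ σ → Tm Δ σ
subT θ (var v) = θ v
subT θ (con c) = con c
subT θ (t · u) = subT θ t · subT θ u

infixr 4 _⊃_
infixr 5 _∨'_
infixr 6 _∧'_
infix 7 _≐_
data Fm (Γ : Ctx) : Set where
  ⊥'   : Fm Γ
  _≐_  : ∀ {σ} → Tm Γ σ → Tm Γ σ → Fm Γ
  _∧'_ : Fm Γ → Fm Γ → Fm Γ
  _∨'_ : Fm Γ → Fm Γ → Fm Γ
  _⊃_  : Fm Γ → Fm Γ → Fm Γ
  all  : ∀ σ → Fm (σ ∷ Γ) → Fm Γ
  ex   : ∀ σ → Fm (σ ∷ Γ) → Fm Γ

¬' : ∀ {Γ} → Fm Γ → Fm Γ
¬' φ = φ ⊃ ⊥'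

⊤' : ∀ {Γ} → Fm Γ
⊤' = ¬' ⊥'

renF : ∀ {Γ Δ} → Ren Γ Δ → Fm Γ → Fm Δ
renF ρ ⊥'        = ⊥'
renF ρ (t ≐ u)   = renT ρ t ≐ renT ρ u
renF ρ (φ ∧' ψ)  = renF ρ φ ∧' renF ρ ψ
renF ρ (φ ∨' ψ)  = renF ρ φ ∨' renF ρ ψ
renF ρ (φ ⊃ ψ)   = renF ρ φ ⊃ renF ρ ψ
renF ρ (all σ φ) = all σ (renF (liftR ρ) φ)
renF ρ (ex σ φ)  = ex σ (renF (liftR ρ) φ)

wkF : ∀ {Γ τ} → Fm Γ → Fm (τ ∷ Γ)
wkF = renF vs

subF : ∀ {Γ Δ} → Sub Γ Δ → Fm Γ → Fm Δ
subF θ ⊥'        = ⊥'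
subF θ (t ≐ u)   = subT θ t ≐ subT θ u
subF θ (φ ∧' ψ)  = subF θ φ ∧' subF θ ψ
subF θ (φ ∨' ψ)  = subF θ φ ∨' subF θ ψ
subF θ (φ ⊃ ψ)   = subF θ φ ⊃ subF θ ψ
subF θ (all σ φ) = all σ (subF (liftS θ) φ)
subF θ (ex σ φ)  = ex σ (subF (liftS θ) φ)

sub0S : ∀ {Γ σ} → Tm Γ σ → Sub (σ ∷ Γ) Γ
sub0S t vz     = t
sub0S t (vs v) = var v

_[_] : ∀ {Γ σ} → Fm (σ ∷ Γ) → Tm Γ σ → Fm Γ
φ [ t ] = subF (sub0S t) φ

stepS : ∀ {Γ} → Sub (ι ∷ Γ) (ι ∷ Γ)
stepS vz     = con suc · var vz
stepS (vs v) = var (vs v)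

data Axiom {Γ : Ctx} : Fm Γ → Set where
  eq-refl  : ∀ {σ} (t : Tm Γ σ) → Axiom (t ≐ t)
  eq-sym   : ∀ {σ} (t u : Tm Γ σ) → Axiom (t ≐ u ⊃ u ≐ t)
  eq-trans : ∀ {σ} (t u v : Tm Γ σ) → Axiom (t ≐ u ⊃ u ≐ v ⊃ t ≐ v)
  eq-cong  : ∀ {σ τ} (f f' : Tm Γ (σ ⇒ τ)) (a a' : Tm Γ σ) →
             Axiom (f ≐ f' ⊃ a ≐ a' ⊃ f · a ≐ f' · a')
  ax-k     : ∀ {ρ σ} (x : Tm Γ ρ) (y : Tm Γ σ) → Axiom (con (k ρ σ) · x · y ≐ x)
  ax-s     : ∀ {ρ σ τ} (x : Tm Γ (ρ ⇒ σ ⇒ τ)) (y : Tm Γ (ρ ⇒ σ)) (z : Tm Γ ρ) →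
             Axiom (con (s ρ σ τ) · x · y · z ≐ x · z · (y · z))
  ax-fst   : ∀ {σ τ} (x : Tm Γ σ) (y : Tm Γ τ) →
             Axiom (con (fst σ τ) · (con (pair σ τ) · x · y) ≐ x)
  ax-snd   : ∀ {σ τ} (x : Tm Γ σ) (y : Tm Γ τ) →
             Axiom (con (snd σ τ) · (con (pair σ τ) · x · y) ≐ y)
  ax-R0    : ∀ {σ} (x : Tm Γ σ) (y : Tm Γ (ι ⇒ σ ⇒ σ)) →
             Axiom (con (rec σ) · x · y · con zero ≐ x)
  ax-RS    : ∀ {σ} (x : Tm Γ σ) (y : Tm Γ (ι ⇒ σ ⇒ σ)) (m : Tm Γ ι) →
             Axiom (con (rec σ) · x · y · (con suc · m) ≐ y · m · (con (rec σ) · x · y · m))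
  ax-Sinj  : (x y : Tm Γ ι) → Axiom (con suc · x ≐ con suc · y ⊃ x ≐ y)
  ax-S≠0   : (x : Tm Γ ι) → Axiom (¬' (con suc · x ≐ con zero))
  ax-ind   : (φ : Fm (ι ∷ Γ)) →
             Axiom (φ [ con zero ] ⊃ all ι (φ ⊃ subF stepS φ) ⊃ all ι φ)

infix 2 _⊢_
data _⊢_ {Γ : Ctx} (Δ : List (Fm Γ)) : Fm Γ → Set where
  hyp   : ∀ {φ} → φ ∈ Δ → Δ ⊢ φ
  ax    : ∀ {φ} → Axiom φ → Δ ⊢ φ
  ⊥E    : ∀ {φ} → Δ ⊢ ⊥' → Δ ⊢ φ
  ∧I    : ∀ {φ ψ} → Δ ⊢ φ → Δ ⊢ ψ → Δ ⊢ φ ∧' ψ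
  ∧E₁   : ∀ {φ ψ} → Δ ⊢ φ ∧' ψ → Δ ⊢ φ
  ∧E₂   : ∀ {φ ψ} → Δ ⊢ φ ∧' ψ → Δ ⊢ ψ
  ∨I₁   : ∀ {φ ψ} → Δ ⊢ φ → Δ ⊢ φ ∨' ψ
  ∨I₂   : ∀ {φ ψ} → Δ ⊢ ψ → Δ ⊢ φ ∨' ψ
  ∨E    : ∀ {φ ψ χ} → Δ ⊢ φ ∨' ψ → φ ∷ Δ ⊢ χ → ψ ∷ Δ ⊢ χ → Δ ⊢ χ
  ⊃I    : ∀ {φ ψ} → φ ∷ Δ ⊢ ψ → Δ ⊢ φ ⊃ ψ
  ⊃E    : ∀ {φ ψ} → Δ ⊢ φ ⊃ ψ → Δ ⊢ φ → Δ ⊢ ψ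
  ∀I    : ∀ {σ φ} → map wkF Δ ⊢ φ → Δ ⊢ all σ φ
  ∀E    : ∀ {σ φ} → Δ ⊢ all σ φ → (t : Tm Γ σ) → Δ ⊢ φ [ t ]
  ∃I    : ∀ {σ φ} (t : Tm Γ σ) → Δ ⊢ φ [ t ] → Δ ⊢ ex σ φ
  ∃E    : ∀ {σ φ ψ} → Δ ⊢ ex σ φ → φ ∷ map wkF Δ ⊢ wkF ψ → Δ ⊢ ψ

-- HA^ω ⊢ φ  (φ may have free variables from Γ)
HA⊢ : ∀ {Γ} → Fm Γ → Set
HA⊢ φ = [] ⊢ φ

_⁺ : Ty → Ty
_⁻ : Ty → Ty
ι ⁺       = ι
(σ ⊗ τ) ⁺ = σ ⁺ ⊗ τ ⁺
(σ ⇒ τ) ⁺ = (σ ⁺ ⇒ τ ⁺) ⊗ (σ ⁺ ⇒ σ ⁺ ⇒ τ ⁻ ⇒ σ ⁻)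
ι ⁻       = ι
(σ ⊗ τ) ⁻ = (σ ⁻ ⊗ τ ⁻) ⊗ ι
(σ ⇒ τ) ⁻ = σ ⁺ ⊗ τ ⁻

fstT : ∀ {Γ σ τ} → Tm Γ (σ ⊗ τ) → Tm Γ σ
fstT {σ = σ} {τ} t = con (fst σ τ) · t

sndT : ∀ {Γ σ τ} → Tm Γ (σ ⊗ τ) → Tm Γ τ
sndT {σ = σ} {τ} t = con (snd σ τ) · t

-- s * t := (fst s) t
-- the types σ, τ are given explicitly since (·)⁺ is not injective
-- ap σ τ f t  is  f * t  for f : (σ → τ)⁺, t : σ⁺
ap : ∀ {Γ} σ τ → Tm Γ ((σ ⇒ τ) ⁺) → Tm Γ (σ ⁺) → Tm Γ (τ ⁺)
ap σ τ f t = fstT f · t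

dom : ∀ {Γ} σ → Tm Γ (σ ⁺) → Fm Γ
app : ∀ {Γ} σ → Tm Γ (σ ⁺) → Tm Γ (σ ⁺) → Tm Γ (σ ⁻) → Fm Γ

dom ι x       = ⊤'
dom (σ ⊗ τ) x = dom σ (fstT x) ∧' dom τ (sndT x)
dom (σ ⇒ τ) x =
  all (σ ⁺) (dom σ (var vz) ⊃ dom τ (ap σ τ (wkT x) (var vz)))
  ∧' all (σ ⁺) (all (σ ⁺) (all (τ ⁻)
       (let u = var (vs (vs vz)) ; v = var (vs vz) ; w = var vz
            x' = wkT (wkT (wkT x))
        in dom σ u ⊃ dom σ v ⊃ app τ (ap σ τ x' u) (ap σ τ x' v) w
           ⊃ app σ u v (sndT x' · u · v · w))))

app ι x y z       = ¬' (x ≐ y)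
app (σ ⊗ τ) x y z =
  (sndT z ≐ con zero ⊃ app σ (fstT x) (fstT y) (fstT (fstT z)))
  ∧' (¬' (sndT z ≐ con zero) ⊃ app τ (sndT x) (sndT y) (sndT (fstT z)))
app (σ ⇒ τ) x y z = dom σ (fstT z) ∧' app τ (ap σ τ x (fstT z)) (ap σ τ y (fstT z)) (sndT z)

Translation : Set
Translation = ∀ {σ} → Const σ → Tm [] (σ ⁺)

#0 : ∀ {Γ σ} → Tm (σ ∷ Γ) σ
#0 = var vz
#1 : ∀ {Γ σ τ} → Tm (τ ∷ σ ∷ Γ) σ
#1 = var (vs vz)
#2 : ∀ {Γ σ τ υ} → Tm (υ ∷ τ ∷ σ ∷ Γ) σ
#2 = var (vs (vs vz))

EqK : Translation → Ty → Ty → Set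
EqK α ρ σ = HA⊢ {σ ⁺ ∷ ρ ⁺ ∷ []}
  (ap σ ρ (ap ρ (σ ⇒ ρ) (emb (α (k ρ σ))) #1) #0 ≐ #1)

EqS : Translation → Ty → Ty → Ty → Set
EqS α ρ σ τ = HA⊢ {ρ ⁺ ∷ (ρ ⇒ σ) ⁺ ∷ (ρ ⇒ σ ⇒ τ) ⁺ ∷ []}
  (ap ρ τ (ap (ρ ⇒ σ) (ρ ⇒ τ) (ap (ρ ⇒ σ ⇒ τ) ((ρ ⇒ σ) ⇒ ρ ⇒ τ) (emb (α (s ρ σ τ))) #2) #1) #0
   ≐ ap σ τ (ap ρ (σ ⇒ τ) #2 #0) (ap ρ σ #1 #0))

EqFst : Translation → Ty → Ty → Set
EqFst α σ τ = HA⊢ {τ ⁺ ∷ σ ⁺ ∷ []}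
  (ap (σ ⊗ τ) σ (emb (α (fst σ τ)))
     (ap τ (σ ⊗ τ) (ap σ (τ ⇒ σ ⊗ τ) (emb (α (pair σ τ))) #1) #0) ≐ #1)

EqSnd : Translation → Ty → Ty → Set
EqSnd α σ τ = HA⊢ {τ ⁺ ∷ σ ⁺ ∷ []}
  (ap (σ ⊗ τ) τ (emb (α (snd σ τ)))
     (ap τ (σ ⊗ τ) (ap σ (τ ⇒ σ ⊗ τ) (emb (α (pair σ τ))) #1) #0) ≐ #0)

EqR0 : Translation → Ty → Set
EqR0 α σ = HA⊢ {(ι ⇒ σ ⇒ σ) ⁺ ∷ σ ⁺ ∷ []}
  (ap ι σ (ap (ι ⇒ σ ⇒ σ) (ι ⇒ σ) (ap σ ((ι ⇒ σ ⇒ σ) ⇒ ι ⇒ σ) (emb (α (rec σ))) #1) #0)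
          (emb (α zero))
   ≐ #1)

EqRS : Translation → Ty → Set
EqRS α σ = HA⊢ {ι ⁺ ∷ (ι ⇒ σ ⇒ σ) ⁺ ∷ σ ⁺ ∷ []}
  (ap ι σ Rxy (ap ι ι (emb (α suc)) #0)
   ≐ ap σ σ (ap ι (σ ⇒ σ) #1 #0) (ap ι σ Rxy #0))
  where
  Rxy : Tm (ι ⁺ ∷ (ι ⇒ σ ⇒ σ) ⁺ ∷ σ ⁺ ∷ []) ((ι ⇒ σ) ⁺)
  Rxy = ap (ι ⇒ σ ⇒ σ) (ι ⇒ σ) (ap σ ((ι ⇒ σ ⇒ σ) ⇒ ι ⇒ σ) (emb (α (rec σ))) #2) #1

{-# OPTIONS --safe #-}
-- Each c^α is a pair (forward map, backward map) assembled from the HA^ω combinators by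
-- bracket abstraction; the equations for * then hold by β-reduction of the forward maps.
-- The work is dom: a backward map must turn an app-witness for two outputs into one for
-- the inputs. For k, pair, fst and snd it is read off directly, using that n ≡ 0 is
-- decidable. For s and R a witness w of app_τ(a, b, w) has to be pushed through a
-- composite, and one must know on which side of an intermediate value c it lies: a
-- discriminator, defined by recursion on τ from a decidable equality on type 0, decides
-- between app_τ(a, c, w) and app_τ(c, b, w). For R the backward maps are themselves
-- primitive recursive: in the start value they pull the witness back step by step, in the
-- step function they search downwards for a step at which the two iterations separate.
module Submission where

open import Defs
open import Data.Product using (Σ; _×_; _,_)
open import Data.List using (List; []; _∷_; map)
open import Data.List.Membership.Propositional using (_∈_)
open import Data.List.Membership.Propositional.Properties using (∈-map⁺; ∈-map⁻)
open import Data.List.Relation.Unary.Any using (here; there)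
open import Relation.Binary.PropositionalEquality hiding ([_])

cong₃ : ∀ {A B C D : Set} (f : A → B → C → D) {a a' b b' c c'} →
        a ≡ a' → b ≡ b' → c ≡ c' → f a b c ≡ f a' b' c'
cong₃ f refl refl refl = refl

renT-renT : ∀ {Γ Δ Ε σ} (ρ₁ : Ren Δ Ε) (ρ₂ : Ren Γ Δ) (t : Tm Γ σ) →
            renT ρ₁ (renT ρ₂ t) ≡ renT (λ v → ρ₁ (ρ₂ v)) t
renT-renT ρ₁ ρ₂ (var v) = refl
renT-renT ρ₁ ρ₂ (con c) = refl
renT-renT ρ₁ ρ₂ (t · u) = cong₂ _·_ (renT-renT ρ₁ ρ₂ t) (renT-renT ρ₁ ρ₂ u)

subT-renT : ∀ {Γ Δ Ε σ} (θ : Sub Δ Ε) (ρ : Ren Γ Δ) (t : Tm Γ σ) →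
            subT θ (renT ρ t) ≡ subT (λ v → θ (ρ v)) t
subT-renT θ ρ (var v) = refl
subT-renT θ ρ (con c) = refl
subT-renT θ ρ (t · u) = cong₂ _·_ (subT-renT θ ρ t) (subT-renT θ ρ u)

renT-subT : ∀ {Γ Δ Ε σ} (ρ : Ren Δ Ε) (θ : Sub Γ Δ) (t : Tm Γ σ) →
            renT ρ (subT θ t) ≡ subT (λ v → renT ρ (θ v)) t
renT-subT ρ θ (var v) = refl
renT-subT ρ θ (con c) = refl
renT-subT ρ θ (t · u) = cong₂ _·_ (renT-subT ρ θ t) (renT-subT ρ θ u)

subT-var : ∀ {Γ σ} (t : Tm Γ σ) → subT var t ≡ t
subT-var (var v) = refl
subT-var (con c) = refl
subT-var (t · u) = cong₂ _·_ (subT-var t) (subT-var u)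

renT-liftR-wkT : ∀ {Γ Δ σ τ} (ρ : Ren Γ Δ) (t : Tm Γ σ) →
                 renT (liftR {τ = τ} ρ) (wkT t) ≡ wkT (renT ρ t)
renT-liftR-wkT ρ t = trans (renT-renT (liftR ρ) vs t) (sym (renT-renT vs ρ t))

subT-liftS-wkT : ∀ {Γ Δ σ τ} (θ : Sub Γ Δ) (t : Tm Γ σ) →
                 subT (liftS {τ = τ} θ) (wkT t) ≡ wkT (subT θ t)
subT-liftS-wkT θ t = trans (subT-renT (liftS θ) vs t) (sym (renT-subT vs θ t))

subT-sub0S-wkT : ∀ {Γ σ τ} (u : Tm Γ τ) (t : Tm Γ σ) → subT (sub0S u) (wkT t) ≡ t
subT-sub0S-wkT u t = trans (subT-renT (sub0S u) vs t) (subT-var t)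

subT-stepS-wkT : ∀ {Γ σ} (t : Tm Γ σ) → subT stepS (wkT t) ≡ wkT t
subT-stepS-wkT t =
  trans (subT-renT stepS vs t) (trans (sym (renT-subT vs var t)) (cong wkT (subT-var t)))

wkT² : ∀ {Γ σ a b} → Tm Γ σ → Tm (b ∷ a ∷ Γ) σ
wkT² t = wkT (wkT t)

wkT³ : ∀ {Γ σ a b c} → Tm Γ σ → Tm (a ∷ b ∷ c ∷ Γ) σ
wkT³ t = wkT (wkT (wkT t))

pairT : ∀ {Γ a b} → Tm Γ a → Tm Γ b → Tm Γ (a ⊗ b)
pairT x y = con (pair _ _) · x · y

renF-dom : ∀ {Γ Δ} σ (ρ : Ren Γ Δ) (t : Tm Γ (σ ⁺)) → renF ρ (dom σ t) ≡ dom σ (renT ρ t)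
renF-app : ∀ {Γ Δ} σ (ρ : Ren Γ Δ) (x y : Tm Γ (σ ⁺)) (z : Tm Γ (σ ⁻)) →
           renF ρ (app σ x y z) ≡ app σ (renT ρ x) (renT ρ y) (renT ρ z)
renF-dom ι ρ t = refl
renF-dom (σ ⊗ τ) ρ t = cong₂ _∧'_ (renF-dom σ ρ _) (renF-dom τ ρ _)
renF-dom (σ ⇒ τ) ρ t = cong₂ _∧'_
  (cong (all _) (cong₂ _⊃_ (renF-dom σ (liftR ρ) #0)
     (trans (renF-dom τ (liftR ρ) _) (cong (λ r → dom τ (fstT r · #0)) (renT-liftR-wkT ρ t)))))
  (cong (all _) (cong (all _) (cong (all _)
     (cong₂ _⊃_ (renF-dom σ _ #2) (cong₂ _⊃_ (renF-dom σ _ #1)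
       (cong₂ _⊃_ (trans (renF-app τ _ _ _ #0) (cong (λ r → app τ (fstT r · #2) (fstT r · #1) #0) e))
                  (trans (renF-app σ _ #2 #1 _) (cong (λ r → app σ #2 #1 (sndT r · #2 · #1 · #0)) e))))))))
  where
  e : renT (liftR (liftR (liftR ρ))) (wkT³ t) ≡ wkT³ (renT ρ t)
  e = trans (renT-liftR-wkT (liftR (liftR ρ)) (wkT² t))
            (cong wkT (trans (renT-liftR-wkT (liftR ρ) (wkT t)) (cong wkT (renT-liftR-wkT ρ t))))
renF-app ι ρ x y z = refl
renF-app (σ ⊗ τ) ρ x y z =
  cong₂ _∧'_ (cong (_ ⊃_) (renF-app σ ρ _ _ _)) (cong (_ ⊃_) (renF-app τ ρ _ _ _))
renF-app (σ ⇒ τ) ρ x y z = cong₂ _∧'_ (renF-dom σ ρ _) (renF-app τ ρ _ _ _)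

subF-dom : ∀ {Γ Δ} σ (θ : Sub Γ Δ) (t : Tm Γ (σ ⁺)) → subF θ (dom σ t) ≡ dom σ (subT θ t)
subF-app : ∀ {Γ Δ} σ (θ : Sub Γ Δ) (x y : Tm Γ (σ ⁺)) (z : Tm Γ (σ ⁻)) →
           subF θ (app σ x y z) ≡ app σ (subT θ x) (subT θ y) (subT θ z)
subF-dom ι θ t = refl
subF-dom (σ ⊗ τ) θ t = cong₂ _∧'_ (subF-dom σ θ _) (subF-dom τ θ _)
subF-dom (σ ⇒ τ) θ t = cong₂ _∧'_
  (cong (all _) (cong₂ _⊃_ (subF-dom σ (liftS θ) #0)
     (trans (subF-dom τ (liftS θ) _) (cong (λ r → dom τ (fstT r · #0)) (subT-liftS-wkT θ t)))))
  (cong (all _) (cong (all _) (cong (all _)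
     (cong₂ _⊃_ (subF-dom σ _ #2) (cong₂ _⊃_ (subF-dom σ _ #1)
       (cong₂ _⊃_ (trans (subF-app τ _ _ _ #0) (cong (λ r → app τ (fstT r · #2) (fstT r · #1) #0) e))
                  (trans (subF-app σ _ #2 #1 _) (cong (λ r → app σ #2 #1 (sndT r · #2 · #1 · #0)) e))))))))
  where
  e : subT (liftS (liftS (liftS θ))) (wkT³ t) ≡ wkT³ (subT θ t)
  e = trans (subT-liftS-wkT (liftS (liftS θ)) (wkT² t))
            (cong wkT (trans (subT-liftS-wkT (liftS θ) (wkT t)) (cong wkT (subT-liftS-wkT θ t))))
subF-app ι θ x y z = refl
subF-app (σ ⊗ τ) θ x y z =
  cong₂ _∧'_ (cong (_ ⊃_) (subF-app σ θ _ _ _)) (cong (_ ⊃_) (subF-app τ θ _ _ _))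
subF-app (σ ⇒ τ) θ x y z = cong₂ _∧'_ (subF-dom σ θ _) (subF-app τ θ _ _ _)

wkF²-dom : ∀ {Γ a b} σ (t : Tm Γ (σ ⁺)) → wkF {τ = b} (wkF {τ = a} (dom σ t)) ≡ dom σ (wkT² t)
wkF²-dom σ t = trans (cong wkF (renF-dom σ vs t)) (renF-dom σ vs _)

wkF³-dom : ∀ {Γ a b c} σ (t : Tm Γ (σ ⁺)) →
           wkF {τ = a} (wkF {τ = b} (wkF {τ = c} (dom σ t))) ≡ dom σ (wkT³ t)
wkF³-dom σ t = trans (cong wkF (wkF²-dom σ t)) (renF-dom σ vs _)

_⊆_ : ∀ {Γ} → List (Fm Γ) → List (Fm Γ) → Set
Δ ⊆ Δ' = ∀ {φ} → φ ∈ Δ → φ ∈ Δ'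

⊆-map-wkF : ∀ {Γ τ} {Δ Δ' : List (Fm Γ)} → Δ ⊆ Δ' → map (wkF {τ = τ}) Δ ⊆ map wkF Δ'
⊆-map-wkF sb m = let (x , m' , e) = ∈-map⁻ wkF m in subst (_∈ _) (sym e) (∈-map⁺ wkF (sb m'))

⊆-∷ : ∀ {Γ} {Δ Δ' : List (Fm Γ)} {ψ} → Δ ⊆ Δ' → (ψ ∷ Δ) ⊆ (ψ ∷ Δ')
⊆-∷ sb (here p) = here p
⊆-∷ sb (there m) = there (sb m)

⊢-mono : ∀ {Γ} {Δ Δ' : List (Fm Γ)} {φ} → Δ ⊆ Δ' → Δ ⊢ φ → Δ' ⊢ φ
⊢-mono sb (hyp m) = hyp (sb m)
⊢-mono sb (ax a) = ax a
⊢-mono sb (⊥E p) = ⊥E (⊢-mono sb p)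
⊢-mono sb (∧I p q) = ∧I (⊢-mono sb p) (⊢-mono sb q)
⊢-mono sb (∧E₁ p) = ∧E₁ (⊢-mono sb p)
⊢-mono sb (∧E₂ p) = ∧E₂ (⊢-mono sb p)
⊢-mono sb (∨I₁ p) = ∨I₁ (⊢-mono sb p)
⊢-mono sb (∨I₂ p) = ∨I₂ (⊢-mono sb p)
⊢-mono sb (∨E p q r) = ∨E (⊢-mono sb p) (⊢-mono (⊆-∷ sb) q) (⊢-mono (⊆-∷ sb) r)
⊢-mono sb (⊃I p) = ⊃I (⊢-mono (⊆-∷ sb) p)
⊢-mono sb (⊃E p q) = ⊃E (⊢-mono sb p) (⊢-mono sb q)
⊢-mono sb (∀I p) = ∀I (⊢-mono (⊆-map-wkF sb) p)
⊢-mono sb (∀E p t) = ∀E (⊢-mono sb p) t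
⊢-mono sb (∃I t p) = ∃I t (⊢-mono sb p)
⊢-mono sb (∃E p q) = ∃E (⊢-mono sb p) (⊢-mono (⊆-∷ (⊆-map-wkF sb)) q)

module _ {Γ : Ctx} {Δ : List (Fm Γ)} where

  ⊢-theorem : ∀ {φ} → [] ⊢ φ → Δ ⊢ φ
  ⊢-theorem = ⊢-mono (λ ())

  ⊢-wk₁ : ∀ {φ ψ} → Δ ⊢ φ → ψ ∷ Δ ⊢ φ
  ⊢-wk₁ = ⊢-mono there

  ⊢-wk₂ : ∀ {φ ψ χ} → Δ ⊢ φ → χ ∷ ψ ∷ Δ ⊢ φ
  ⊢-wk₂ = ⊢-mono (λ m → there (there m))

  ⊢-wk₃ : ∀ {φ ψ χ ω} → Δ ⊢ φ → ω ∷ χ ∷ ψ ∷ Δ ⊢ φ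
  ⊢-wk₃ = ⊢-mono (λ m → there (there (there m)))

  h₀ : ∀ {φ} → φ ∷ Δ ⊢ φ
  h₀ = hyp (here refl)
  h₁ : ∀ {φ ψ} → ψ ∷ φ ∷ Δ ⊢ φ
  h₁ = hyp (there (here refl))
  h₂ : ∀ {φ ψ χ} → χ ∷ ψ ∷ φ ∷ Δ ⊢ φ
  h₂ = hyp (there (there (here refl)))
  h₃ : ∀ {φ ψ χ ω} → ω ∷ χ ∷ ψ ∷ φ ∷ Δ ⊢ φ
  h₃ = hyp (there (there (there (here refl))))
  h₄ : ∀ {φ ψ χ ω κ} → κ ∷ ω ∷ χ ∷ ψ ∷ φ ∷ Δ ⊢ φ
  h₄ = hyp (there (there (there (there (here refl)))))

  cast : ∀ {φ ψ} → φ ≡ ψ → Δ ⊢ φ → Δ ⊢ ψ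
  cast refl p = p

  ⊤-intro : Δ ⊢ ⊤'
  ⊤-intro = ⊃I h₀

  induction : (φ : Fm (ι ∷ Γ)) → Δ ⊢ φ [ con zero ] → Δ ⊢ all ι (φ ⊃ subF stepS φ) → Δ ⊢ all ι φ
  induction φ base step = ⊃E (⊃E (ax (ax-ind φ)) base) step

  infixr 5 _∙_

  ≐-refl : ∀ {σ} (t : Tm Γ σ) → Δ ⊢ t ≐ t
  ≐-refl t = ax (eq-refl t)

  ≐-sym : ∀ {σ} {t u : Tm Γ σ} → Δ ⊢ t ≐ u → Δ ⊢ u ≐ t
  ≐-sym p = ⊃E (ax (eq-sym _ _)) p

  _∙_ : ∀ {σ} {t u v : Tm Γ σ} → Δ ⊢ t ≐ u → Δ ⊢ u ≐ v → Δ ⊢ t ≐ v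
  p ∙ q = ⊃E (⊃E (ax (eq-trans _ _ _)) p) q

  ≐-cong : ∀ {σ τ} {f f' : Tm Γ (σ ⇒ τ)} {a a' : Tm Γ σ} →
           Δ ⊢ f ≐ f' → Δ ⊢ a ≐ a' → Δ ⊢ f · a ≐ f' · a'
  ≐-cong p q = ⊃E (⊃E (ax (eq-cong _ _ _ _)) p) q

  ≐-congˡ : ∀ {σ τ} {f f' : Tm Γ (σ ⇒ τ)} (a : Tm Γ σ) → Δ ⊢ f ≐ f' → Δ ⊢ f · a ≐ f' · a
  ≐-congˡ a p = ≐-cong p (≐-refl a)

  ≐-congʳ : ∀ {σ τ} (f : Tm Γ (σ ⇒ τ)) {a a' : Tm Γ σ} → Δ ⊢ a ≐ a' → Δ ⊢ f · a ≐ f · a'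
  ≐-congʳ f q = ≐-cong (≐-refl f) q

  ≡⇒≐ : ∀ {σ} {t u : Tm Γ σ} → t ≡ u → Δ ⊢ t ≐ u
  ≡⇒≐ {t = t} refl = ≐-refl t

  ≐-fst : ∀ {σ τ} {t u : Tm Γ (σ ⊗ τ)} → Δ ⊢ t ≐ u → Δ ⊢ fstT t ≐ fstT u
  ≐-fst = ≐-congʳ _

  ≐-snd : ∀ {σ τ} {t u : Tm Γ (σ ⊗ τ)} → Δ ⊢ t ≐ u → Δ ⊢ sndT t ≐ sndT u
  ≐-snd = ≐-congʳ _

≐zero-dec : ∀ {Γ} {Δ : List (Fm Γ)} (n : Tm Γ ι) → Δ ⊢ (n ≐ con zero) ∨' ¬' (n ≐ con zero)
≐zero-dec n = ⊢-theorem (∀E (induction (#0 ≐ con zero ∨' ¬' (#0 ≐ con zero))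
  (∨I₁ (≐-refl _)) (∀I (⊃I (∨I₂ (ax (ax-S≠0 #0)))))) n)

-- Combinatory expressions and bracket abstraction

infixl 9 _⊙_
data Expr (Θ : Ctx) : Ty → Set where
  bv  : ∀ {τ} → Var Θ τ → Expr Θ τ
  cn  : ∀ {τ} → Const τ → Expr Θ τ
  cl  : ∀ {τ} → Expr [] τ → Expr Θ τ
  _⊙_ : ∀ {σ τ} → Expr Θ (σ ⇒ τ) → Expr Θ σ → Expr Θ τ

v0 : ∀ {Θ a} → Expr (a ∷ Θ) a
v0 = bv vz
v1 : ∀ {Θ a b} → Expr (b ∷ a ∷ Θ) a
v1 = bv (vs vz)
v2 : ∀ {Θ a b c} → Expr (c ∷ b ∷ a ∷ Θ) a
v2 = bv (vs (vs vz))
v3 : ∀ {Θ a b c d} → Expr (d ∷ c ∷ b ∷ a ∷ Θ) a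
v3 = bv (vs (vs (vs vz)))
v4 : ∀ {Θ a b c d e} → Expr (e ∷ d ∷ c ∷ b ∷ a ∷ Θ) a
v4 = bv (vs (vs (vs (vs vz))))
v5 : ∀ {Θ a b c d e f} → Expr (f ∷ e ∷ d ∷ c ∷ b ∷ a ∷ Θ) a
v5 = bv (vs (vs (vs (vs (vs vz)))))

pairᴱ : ∀ {Θ a b} → Expr Θ a → Expr Θ b → Expr Θ (a ⊗ b)
pairᴱ x y = cn (pair _ _) ⊙ x ⊙ y

fstᴱ : ∀ {Θ a b} → Expr Θ (a ⊗ b) → Expr Θ a
fstᴱ x = cn (fst _ _) ⊙ x

sndᴱ : ∀ {Θ a b} → Expr Θ (a ⊗ b) → Expr Θ b
sndᴱ x = cn (snd _ _) ⊙ x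

noSub : ∀ {Γ} → Sub [] Γ
noSub ()

ext : ∀ {Θ Γ σ} → Sub Θ Γ → Tm Γ σ → Sub (σ ∷ Θ) Γ
ext θ u vz = u
ext θ u (vs v) = θ v

wkS : ∀ {Θ Γ τ} → Sub Θ Γ → Sub Θ (τ ∷ Γ)
wkS θ v = wkT (θ v)

wkS³ : ∀ {Θ Γ a b c} → Sub Θ Γ → Sub Θ (a ∷ b ∷ c ∷ Γ)
wkS³ θ = wkS (wkS (wkS θ))

eval : ∀ {Θ Γ τ} → Expr Θ τ → Sub Θ Γ → Tm Γ τ
eval (bv v) θ = θ v
eval (cn c) θ = con c
eval (cl M) θ = eval M noSub
eval (f ⊙ a) θ = eval f θ · eval a θ

eval-cong : ∀ {Θ Γ τ} (M : Expr Θ τ) {θ θ' : Sub Θ Γ} →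
            (∀ {σ} (v : Var Θ σ) → θ v ≡ θ' v) → eval M θ ≡ eval M θ'
eval-cong (bv v) e = e v
eval-cong (cn c) e = refl
eval-cong (cl M) e = refl
eval-cong (f ⊙ a) e = cong₂ _·_ (eval-cong f e) (eval-cong a e)

renT-eval : ∀ {Θ Γ Δ τ} (ρ : Ren Γ Δ) (M : Expr Θ τ) (θ : Sub Θ Γ) →
            renT ρ (eval M θ) ≡ eval M (λ v → renT ρ (θ v))
renT-eval ρ (bv v) θ = refl
renT-eval ρ (cn c) θ = refl
renT-eval ρ (cl M) θ = trans (renT-eval ρ M noSub) (eval-cong M (λ ()))
renT-eval ρ (f ⊙ a) θ = cong₂ _·_ (renT-eval ρ f θ) (renT-eval ρ a θ)

subT-eval : ∀ {Θ Γ Δ τ} (θ' : Sub Γ Δ) (M : Expr Θ τ) (θ : Sub Θ Γ) →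
            subT θ' (eval M θ) ≡ eval M (λ v → subT θ' (θ v))
subT-eval θ' (bv v) θ = refl
subT-eval θ' (cn c) θ = refl
subT-eval θ' (cl M) θ = trans (subT-eval θ' M noSub) (eval-cong M (λ ()))
subT-eval θ' (f ⊙ a) θ = cong₂ _·_ (subT-eval θ' f θ) (subT-eval θ' a θ)

wkT-eval : ∀ {Θ Γ τ σ} (M : Expr Θ τ) (θ : Sub Θ Γ) → wkT {τ = σ} (eval M θ) ≡ eval M (wkS θ)
wkT-eval M θ = renT-eval vs M θ

wkT³-eval : ∀ {Θ Γ τ a b c} (M : Expr Θ τ) (θ : Sub Θ Γ) →
            wkT³ {a = a} {b} {c} (eval M θ) ≡ eval M (wkS³ θ)
wkT³-eval M θ = trans (cong wkT (cong wkT (wkT-eval M θ)))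
                      (trans (cong wkT (wkT-eval M (wkS θ))) (wkT-eval M (wkS (wkS θ))))

renT-closed : ∀ {Γ Δ τ} (M : Expr [] τ) (ρ : Ren Γ Δ) → renT ρ (eval M noSub) ≡ eval M noSub
renT-closed M ρ = trans (renT-eval ρ M noSub) (eval-cong M (λ ()))

subT-closed : ∀ {Γ Δ τ} (M : Expr [] τ) (θ : Sub Γ Δ) → subT θ (eval M noSub) ≡ eval M noSub
subT-closed M θ = trans (subT-eval θ M noSub) (eval-cong M (λ ()))

abs : ∀ {Θ σ τ} → Expr (σ ∷ Θ) τ → Expr Θ (σ ⇒ τ)
abs {σ = σ} (bv vz) = cn (s σ (σ ⇒ σ) σ) ⊙ cn (k σ (σ ⇒ σ)) ⊙ cn (k σ σ)
abs {σ = σ} {τ} (bv (vs v)) = cn (k τ σ) ⊙ bv v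
abs {σ = σ} {τ} (cn c) = cn (k τ σ) ⊙ cn c
abs {σ = σ} {τ} (cl M) = cn (k τ σ) ⊙ cl M
abs {σ = σ} (_⊙_ {ρ} {τ} f a) = cn (s σ ρ τ) ⊙ abs f ⊙ abs a

abs-β : ∀ {Θ Γ σ τ} {Δ : List (Fm Γ)} (M : Expr (σ ∷ Θ) τ) (θ : Sub Θ Γ) (u : Tm Γ σ) →
        Δ ⊢ eval (abs M) θ · u ≐ eval M (ext θ u)
abs-β (bv vz) θ u = ax (ax-s _ _ _) ∙ ax (ax-k _ _)
abs-β (bv (vs v)) θ u = ax (ax-k _ _)
abs-β (cn c) θ u = ax (ax-k _ _)
abs-β (cl M) θ u = ax (ax-k _ _)
abs-β (f ⊙ a) θ u = ax (ax-s _ _ _) ∙ ≐-cong (abs-β f θ u) (abs-β a θ u)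

-- Opaque because nested bracket abstractions grow exponentially and must never be unfolded
-- during type checking.
opaque
  ƛ : ∀ {Θ σ τ} → Expr (σ ∷ Θ) τ → Expr Θ (σ ⇒ τ)
  ƛ = abs

opaque
  unfolding ƛ

  ƛ-β : ∀ {Θ Γ σ τ} {Δ : List (Fm Γ)} (M : Expr (σ ∷ Θ) τ) (θ : Sub Θ Γ) (u : Tm Γ σ) →
        Δ ⊢ eval (ƛ M) θ · u ≐ eval M (ext θ u)
  ƛ-β = abs-β

module _ {Γ : Ctx} {Δ : List (Fm Γ)} where

  abs²-β : ∀ {Θ a b τ} (M : Expr (b ∷ a ∷ Θ) τ) (θ : Sub Θ Γ) (x : Tm Γ a) (y : Tm Γ b) →
           Δ ⊢ eval (abs (abs M)) θ · x · y ≐ eval M (ext (ext θ x) y)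
  abs²-β M θ x y = ≐-congˡ y (abs-β (abs M) θ x) ∙ abs-β M (ext θ x) y

  abs³-β : ∀ {Θ a b c τ} (M : Expr (c ∷ b ∷ a ∷ Θ) τ) (θ : Sub Θ Γ) (x : Tm Γ a) (y : Tm Γ b) (z : Tm Γ c) →
           Δ ⊢ eval (abs (abs (abs M))) θ · x · y · z ≐ eval M (ext (ext (ext θ x) y) z)
  abs³-β M θ x y z = ≐-congˡ z (abs²-β (abs M) θ x y) ∙ abs-β M (ext (ext θ x) y) z

  ƛ²-β : ∀ {Θ a b τ} (M : Expr (b ∷ a ∷ Θ) τ) (θ : Sub Θ Γ) (x : Tm Γ a) (y : Tm Γ b) →
         Δ ⊢ eval (ƛ (ƛ M)) θ · x · y ≐ eval M (ext (ext θ x) y)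
  ƛ²-β M θ x y = ≐-congˡ y (ƛ-β (ƛ M) θ x) ∙ ƛ-β M (ext θ x) y

  ƛ³-β : ∀ {Θ a b c τ} (M : Expr (c ∷ b ∷ a ∷ Θ) τ) (θ : Sub Θ Γ) (x : Tm Γ a) (y : Tm Γ b) (z : Tm Γ c) →
         Δ ⊢ eval (ƛ (ƛ (ƛ M))) θ · x · y · z ≐ eval M (ext (ext (ext θ x) y) z)
  ƛ³-β M θ x y z = ≐-congˡ z (ƛ²-β (ƛ M) θ x y) ∙ ƛ-β M (ext (ext θ x) y) z

module Instantiate³ {Γ : Ctx} {σ τ : Ty} (u v : Tm Γ (σ ⁺)) (w : Tm Γ (τ ⁻)) where

  θu : Sub ((τ ⁻) ∷ (σ ⁺) ∷ (σ ⁺) ∷ Γ) ((τ ⁻) ∷ (σ ⁺) ∷ Γ)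
  θu = liftS (liftS (sub0S u))
  θv : Sub ((τ ⁻) ∷ (σ ⁺) ∷ Γ) ((τ ⁻) ∷ Γ)
  θv = liftS (sub0S v)
  θw : Sub ((τ ⁻) ∷ Γ) Γ
  θw = sub0S w

  subT³ : ∀ {ρ} → Tm ((τ ⁻) ∷ (σ ⁺) ∷ (σ ⁺) ∷ Γ) ρ → Tm Γ ρ
  subT³ t = subT θw (subT θv (subT θu t))

  subF³ : Fm ((τ ⁻) ∷ (σ ⁺) ∷ (σ ⁺) ∷ Γ) → Fm Γ
  subF³ φ = subF θw (subF θv (subF θu φ))

  subF³-dom : ∀ ρ t → subF³ (dom ρ t) ≡ dom ρ (subT³ t)
  subF³-dom ρ t =
    trans (cong (subF θw) (trans (cong (subF θv) (subF-dom ρ θu t)) (subF-dom ρ θv _))) (subF-dom ρ θw _)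

  subF³-app : ∀ ρ x y z → subF³ (app ρ x y z) ≡ app ρ (subT³ x) (subT³ y) (subT³ z)
  subF³-app ρ x y z =
    trans (cong (subF θw) (trans (cong (subF θv) (subF-app ρ θu x y z)) (subF-app ρ θv _ _ _)))
          (subF-app ρ θw _ _ _)

  subT³-#2 : subT³ #2 ≡ u
  subT³-#2 = trans (cong (subT θw) (subT-liftS-wkT (sub0S v) (wkT u)))
                   (trans (subT-sub0S-wkT w (subT (sub0S v) (wkT u))) (subT-sub0S-wkT v u))

  subT³-#1 : subT³ #1 ≡ v
  subT³-#1 = subT-sub0S-wkT w v

  subT³-wkT³ : ∀ {ρ} (x : Tm Γ ρ) → subT³ (wkT³ x) ≡ x
  subT³-wkT³ x = trans (cong (subT θw) (trans (cong (subT θv) (subT-liftS-wkT (liftS (sub0S u)) (wkT² x)))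
    (trans (subT-liftS-wkT (sub0S v) (subT (liftS (sub0S u)) (wkT² x)))
           (cong wkT (trans (cong (subT (sub0S v)) (subT-liftS-wkT (sub0S u) (wkT x)))
                            (trans (subT-sub0S-wkT v _) (subT-sub0S-wkT u x)))))))
    (subT-sub0S-wkT w x)

module _ {Γ : Ctx} {Δ : List (Fm Γ)} where

  dom-ap : ∀ σ τ {x : Tm Γ ((σ ⇒ τ) ⁺)} {u : Tm Γ (σ ⁺)} →
           Δ ⊢ dom (σ ⇒ τ) x → Δ ⊢ dom σ u → Δ ⊢ dom τ (ap σ τ x u)
  dom-ap σ τ {x} {u} h d = ⊃E (cast E (∀E (∧E₁ h) u)) d
    where
    E : subF (sub0S u) (dom σ #0 ⊃ dom τ (fstT (wkT x) · #0)) ≡ (dom σ u ⊃ dom τ (fstT x · u))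
    E = cong₂ _⊃_ (subF-dom σ _ #0)
                  (trans (subF-dom τ _ _) (cong (λ r → dom τ (fstT r · u)) (subT-sub0S-wkT u x)))

  dom-back : ∀ σ τ {x : Tm Γ ((σ ⇒ τ) ⁺)} {u v : Tm Γ (σ ⁺)} {w : Tm Γ (τ ⁻)} →
             Δ ⊢ dom (σ ⇒ τ) x → Δ ⊢ dom σ u → Δ ⊢ dom σ v →
             Δ ⊢ app τ (ap σ τ x u) (ap σ τ x v) w → Δ ⊢ app σ u v (sndT x · u · v · w)
  dom-back σ τ {x} {u} {v} {w} h du dv a =
    ⊃E (⊃E (⊃E (cast E (∀E (∀E (∀E (∧E₂ h) u) v) w)) du) dv) a
    where
    open Instantiate³ {Γ} {σ} {τ} u v w
    E : subF³ (dom σ #2 ⊃ dom σ #1 ⊃ app τ (ap σ τ (wkT³ x) #2) (ap σ τ (wkT³ x) #1) #0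
                  ⊃ app σ #2 #1 (sndT (wkT³ x) · #2 · #1 · #0))
        ≡ (dom σ u ⊃ dom σ v ⊃ app τ (ap σ τ x u) (ap σ τ x v) w ⊃ app σ u v (sndT x · u · v · w))
    E = cong₂ _⊃_ (trans (subF³-dom σ #2) (cong (dom σ) subT³-#2))
       (cong₂ _⊃_ (trans (subF³-dom σ #1) (cong (dom σ) subT³-#1))
       (cong₂ _⊃_ (trans (subF³-app τ _ _ _)
                     (cong₃ (λ a b c → app τ (fstT a · b) (fstT a · c) w) (subT³-wkT³ x) subT³-#2 subT³-#1))
                  (trans (subF³-app σ _ _ _)
                     (cong₃ (λ a b c → app σ b c (sndT a · b · c · w)) (subT³-wkT³ x) subT³-#2 subT³-#1))))

dom-wkF² : ∀ σ {Γ a b} {Δ : List (Fm (b ∷ a ∷ Γ))} {t : Tm Γ (σ ⁺)} →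
           Δ ⊢ wkF (wkF (dom σ t)) → Δ ⊢ dom σ (wkT² t)
dom-wkF² σ = cast (wkF²-dom σ _)

app-irrefl : ∀ σ {Γ} {Δ : List (Fm Γ)} {a b : Tm Γ (σ ⁺)} {c} →
             Δ ⊢ a ≐ b → Δ ⊢ app σ a b c → Δ ⊢ ⊥'
app-irrefl ι p q = ⊃E q p
app-irrefl (σ ⊗ τ) p q =
  app-irrefl τ (≐-snd p) (⊃E (∧E₂ q) (⊃I (app-irrefl σ (≐-fst (⊢-wk₁ p)) (⊃E (⊢-wk₁ (∧E₁ q)) h₀))))
app-irrefl (σ ⇒ τ) {c = c} p q = app-irrefl τ (≐-congˡ (fstT c) (≐-fst p)) (∧E₂ q)

-- dom-resp is a closed theorem, so that it can be used under the binders of dom (σ ⇒ τ),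
-- where the hypotheses have been weakened.
dom-resp : ∀ σ {Γ} {t t' : Tm Γ (σ ⁺)} → [] ⊢ t ≐ t' ⊃ dom σ t ⊃ dom σ t'

dom-resp-≐ : ∀ σ {Γ} {Δ : List (Fm Γ)} {t t' : Tm Γ (σ ⁺)} →
             Δ ⊢ t ≐ t' → Δ ⊢ dom σ t → Δ ⊢ dom σ t'
dom-resp-≐ σ p d = ⊃E (⊃E (⊢-theorem (dom-resp σ)) p) d

app-resp-≐ : ∀ σ {Γ} {Δ : List (Fm Γ)} {a a' b b' : Tm Γ (σ ⁺)} {c c'} →
             Δ ⊢ a ≐ a' → Δ ⊢ b ≐ b' → Δ ⊢ c ≐ c' → Δ ⊢ app σ a b c → Δ ⊢ app σ a' b' c'

dom-resp ι = ⊃I (⊃I h₀)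
dom-resp (σ ⊗ τ) =
  ⊃I (⊃I (∧I (dom-resp-≐ σ (≐-fst h₁) (∧E₁ h₀)) (dom-resp-≐ τ (≐-snd h₁) (∧E₂ h₀))))
dom-resp (σ ⇒ τ) {Γ} {t} {t'} = ⊃I (⊃I (∧I
  (∀I (⊃I (dom-resp-≐ τ (≐-congˡ #0 (≐-fst h₂)) (dom-ap σ τ (cast (renF-dom (σ ⇒ τ) vs t) h₁) h₀))))
  (∀I (∀I (∀I (⊃I (⊃I (⊃I
    (app-resp-≐ σ (≐-refl #2) (≐-refl #1) (≐-congˡ #0 (≐-congˡ #1 (≐-congˡ #2 (≐-snd h₄))))
      (dom-back σ τ (cast (wkF³-dom (σ ⇒ τ) t) h₃) h₂ h₁
        (app-resp-≐ τ (≐-congˡ #2 (≐-fst (≐-sym h₄))) (≐-congˡ #1 (≐-fst (≐-sym h₄))) (≐-refl #0) h₀)))))))))))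

app-resp-≐ ι pa pb pc q = ⊃I (⊃E (⊢-wk₁ q) (⊢-wk₁ pa ∙ h₀ ∙ ≐-sym (⊢-wk₁ pb)))
app-resp-≐ (σ ⊗ τ) pa pb pc q = ∧I
  (⊃I (app-resp-≐ σ (≐-fst (⊢-wk₁ pa)) (≐-fst (⊢-wk₁ pb)) (≐-fst (≐-fst (⊢-wk₁ pc)))
         (⊃E (⊢-wk₁ (∧E₁ q)) (≐-snd (⊢-wk₁ pc) ∙ h₀))))
  (⊃I (app-resp-≐ τ (≐-snd (⊢-wk₁ pa)) (≐-snd (⊢-wk₁ pb)) (≐-snd (≐-fst (⊢-wk₁ pc)))
         (⊃E (⊢-wk₁ (∧E₂ q)) (⊃I (⊃E h₁ (≐-sym (≐-snd (⊢-wk₂ pc)) ∙ h₀))))))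
app-resp-≐ (σ ⇒ τ) pa pb pc q = ∧I (dom-resp-≐ σ (≐-fst pc) (∧E₁ q))
  (app-resp-≐ τ (≐-cong (≐-fst pa) (≐-fst pc)) (≐-cong (≐-fst pb) (≐-fst pc)) (≐-snd pc) (∧E₂ q))

app⇒-intro : ∀ σ τ {Γ} {Δ : List (Fm Γ)} {f f' : Tm Γ ((σ ⇒ τ) ⁺)} {z w} → Δ ⊢ dom σ z →
             Δ ⊢ app τ (ap σ τ f z) (ap σ τ f' z) w → Δ ⊢ app (σ ⇒ τ) f f' (pairT z w)
app⇒-intro σ τ dz a = ∧I (dom-resp-≐ σ (≐-sym (ax (ax-fst _ _))) dz)
  (app-resp-≐ τ (≐-congʳ _ (≐-sym (ax (ax-fst _ _)))) (≐-congʳ _ (≐-sym (ax (ax-fst _ _))))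
                (≐-sym (ax (ax-snd _ _))) a)

mkFun : ∀ {Θ} σ τ → Expr ((σ ⁺) ∷ Θ) (τ ⁺) → Expr ((τ ⁻) ∷ (σ ⁺) ∷ (σ ⁺) ∷ Θ) (σ ⁻) →
        Expr Θ ((σ ⇒ τ) ⁺)
mkFun σ τ M N = pairᴱ (ƛ M) (ƛ (ƛ (ƛ N)))

module _ {Γ : Ctx} {Δ : List (Fm Γ)} {Θ} (σ τ : Ty) (M : Expr ((σ ⁺) ∷ Θ) (τ ⁺))
         (N : Expr ((τ ⁻) ∷ (σ ⁺) ∷ (σ ⁺) ∷ Θ) (σ ⁻)) (θ : Sub Θ Γ) where

  mkFun-ap : (u : Tm Γ (σ ⁺)) → Δ ⊢ ap σ τ (eval (mkFun σ τ M N) θ) u ≐ eval M (ext θ u)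
  mkFun-ap u = ≐-congˡ u (ax (ax-fst _ _)) ∙ ƛ-β M θ u

  mkFun-back : ∀ u v w →
               Δ ⊢ sndT (eval (mkFun σ τ M N) θ) · u · v · w ≐ eval N (ext (ext (ext θ u) v) w)
  mkFun-back u v w = ≐-congˡ w (≐-congˡ v (≐-congˡ u (ax (ax-snd _ _)))) ∙ ƛ³-β N θ u v w

dom-mkFun : ∀ {Θ Γ} σ τ (M : Expr ((σ ⁺) ∷ Θ) (τ ⁺)) N (θ : Sub Θ Γ) {Δ : List (Fm Γ)} →
  map wkF Δ ⊢ dom σ #0 ⊃ dom τ (eval M (ext (wkS θ) #0)) →
  map wkF (map wkF (map wkF Δ)) ⊢
    dom σ #2 ⊃ dom σ #1 ⊃ app τ (eval M (ext (wkS³ θ) #2)) (eval M (ext (wkS³ θ) #1)) #0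
    ⊃ app σ #2 #1 (eval N (ext (ext (ext (wkS³ θ) #2) #1) #0)) →
  Δ ⊢ dom (σ ⇒ τ) (eval (mkFun σ τ M N) θ)
dom-mkFun {Θ} {Γ} σ τ M N θ fwd back = ∧I
  (∀I (⊃I (dom-resp-≐ τ (≐-sym (≐-congˡ #0 (≐-fst (≡⇒≐ (wkT-eval F θ))) ∙ mkFun-ap σ τ M N _ #0))
                         (⊃E (⊢-wk₁ fwd) h₀))))
  (∀I (∀I (∀I (⊃I (⊃I (⊃I
    (app-resp-≐ σ (≐-refl #2) (≐-refl #1)
      (≐-sym (≐-congˡ #0 (≐-congˡ #1 (≐-congˡ #2 (≐-snd F³))) ∙ mkFun-back σ τ M N _ #2 #1 #0))
      (⊃E (⊃E (⊃E (⊢-wk₃ back) h₂) h₁)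
        (app-resp-≐ τ (≐-congˡ #2 (≐-fst F³) ∙ mkFun-ap σ τ M N _ #2)
                      (≐-congˡ #1 (≐-fst F³) ∙ mkFun-ap σ τ M N _ #1) (≐-refl #0) h₀)))))))))
  where
  F : Expr Θ ((σ ⇒ τ) ⁺)
  F = mkFun σ τ M N
  F³ : ∀ {a b c} {Δ' : List (Fm (a ∷ b ∷ c ∷ Γ))} → Δ' ⊢ wkT³ (eval F θ) ≐ eval F (wkS³ θ)
  F³ = ≡⇒≐ (wkT³-eval F θ)

-- k, pair, fst, snd and suc

dummy⁻ : ∀ {Θ} σ → Expr Θ (σ ⁻)
dummy⁺ : ∀ {Θ} σ → Expr Θ (σ ⁺)
dummy⁻ ι = cn zero
dummy⁻ (σ ⊗ τ) = pairᴱ (pairᴱ (dummy⁻ σ) (dummy⁻ τ)) (cn zero)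
dummy⁻ (σ ⇒ τ) = pairᴱ (dummy⁺ σ) (dummy⁻ τ)
dummy⁺ ι = cn zero
dummy⁺ (σ ⊗ τ) = pairᴱ (dummy⁺ σ) (dummy⁺ τ)
dummy⁺ (σ ⇒ τ) = pairᴱ (ƛ (dummy⁺ τ)) (ƛ (ƛ (ƛ (dummy⁻ σ))))

idSub₁ : ∀ {σ} → Sub (σ ∷ []) (σ ∷ [])
idSub₁ = ext (wkS noSub) #0

emb-closed : ∀ {Γ τ} (M : Expr [] τ) → emb {Γ} (eval M noSub) ≡ eval M noSub
emb-closed M = renT-closed M closedRen

emb-mkFun-ap : ∀ {Γ} {Δ : List (Fm Γ)} σ τ (M : Expr ((σ ⁺) ∷ []) (τ ⁺)) N (u : Tm Γ (σ ⁺)) →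
               Δ ⊢ ap σ τ (emb (eval (mkFun σ τ M N) noSub)) u ≐ eval M (ext noSub u)
emb-mkFun-ap σ τ M N u =
  ≐-congˡ u (≐-fst (≡⇒≐ (emb-closed (mkFun σ τ M N)))) ∙ mkFun-ap σ τ M N noSub u

sucᵅ : Expr [] ((ι ⇒ ι) ⁺)
sucᵅ = mkFun ι ι (cn suc ⊙ v0) (cn zero)

dom-suc : HA⊢ {[]} (dom (ι ⇒ ι) (eval sucᵅ noSub))
dom-suc = dom-mkFun ι ι (cn suc ⊙ v0) (cn zero) noSub
  (⊃I ⊤-intro) (⊃I (⊃I (⊃I (⊃I (⊃E h₁ (≐-congʳ (con suc) h₀))))))

constᴱ : ∀ σ ρ → Expr (ρ ⁺ ∷ []) ((σ ⇒ ρ) ⁺)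
constᴱ σ ρ = mkFun σ ρ v1 (dummy⁻ σ)

kᵅ : ∀ ρ σ → Expr [] ((ρ ⇒ σ ⇒ ρ) ⁺)
kᵅ ρ σ = mkFun ρ (σ ⇒ ρ) (constᴱ σ ρ) (sndᴱ v0)

dom-k : ∀ ρ σ → HA⊢ {[]} (dom (ρ ⇒ σ ⇒ ρ) (eval (kᵅ ρ σ) noSub))
dom-k ρ σ = dom-mkFun ρ (σ ⇒ ρ) (constᴱ σ ρ) (sndᴱ v0) noSub
  (⊃I (dom-mkFun σ ρ v1 (dummy⁻ σ) idSub₁
         (⊃I (cast (renF-dom ρ vs #0) h₁))
         (⊃I (⊃I (⊃I (⊥E (app-irrefl ρ (≐-refl _) h₀)))))))
  (⊃I (⊃I (⊃I (app-resp-≐ ρ (const-ap _) (const-ap _) (≐-refl _) (∧E₂ h₀)))))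
  where
  const-ap : ∀ {Γ} {Δ : List (Fm Γ)} (θ : Sub (ρ ⁺ ∷ []) Γ) {u} → Δ ⊢ ap σ ρ (eval (constᴱ σ ρ) θ) u ≐ θ vz
  const-ap θ = mkFun-ap σ ρ v1 (dummy⁻ σ) θ _

k-β : ∀ ρ σ → HA⊢ {σ ⁺ ∷ ρ ⁺ ∷ []} (ap σ ρ (ap ρ (σ ⇒ ρ) (emb (eval (kᵅ ρ σ) noSub)) #1) #0 ≐ #1)
k-β ρ σ = ≐-congˡ #0 (≐-fst (emb-mkFun-ap ρ (σ ⇒ ρ) (constᴱ σ ρ) (sndᴱ v0) #1))
        ∙ mkFun-ap σ ρ v1 (dummy⁻ σ) (ext noSub #1) #0

pairWithᴱ : ∀ σ τ → Expr (σ ⁺ ∷ []) ((τ ⇒ σ ⊗ τ) ⁺)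
pairWithᴱ σ τ = mkFun τ (σ ⊗ τ) (pairᴱ v1 v0) (sndᴱ (fstᴱ v0))

pairWith-ap : ∀ σ τ {Γ} {Δ : List (Fm Γ)} (θ : Sub (σ ⁺ ∷ []) Γ) u →
              Δ ⊢ ap τ (σ ⊗ τ) (eval (pairWithᴱ σ τ) θ) u ≐ pairT (θ vz) u
pairWith-ap σ τ θ u = mkFun-ap τ (σ ⊗ τ) (pairᴱ v1 v0) (sndᴱ (fstᴱ v0)) θ u

-- For pair x, a witness for app_{σ⊗τ}(⟨x,y⟩, ⟨x,y'⟩) cannot select the first component.
dom-pairWith : ∀ σ τ → HA⊢ {σ ⁺ ∷ []} (dom σ #0 ⊃ dom (τ ⇒ σ ⊗ τ) (eval (pairWithᴱ σ τ) idSub₁))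
dom-pairWith σ τ = ⊃I (dom-mkFun τ (σ ⊗ τ) (pairᴱ v1 v0) (sndᴱ (fstᴱ v0)) idSub₁
  (⊃I (∧I (dom-resp-≐ σ (≐-sym (ax (ax-fst _ _))) (cast (renF-dom σ vs #0) h₁))
          (dom-resp-≐ τ (≐-sym (ax (ax-snd _ _))) h₀)))
  (⊃I (⊃I (⊃I (∨E (≐zero-dec (sndT #0))
    (⊥E (app-irrefl σ (ax (ax-fst _ _) ∙ ≐-sym (ax (ax-fst _ _))) (⊃E (∧E₁ (⊢-wk₁ h₀)) h₀)))
    (app-resp-≐ τ (ax (ax-snd _ _)) (ax (ax-snd _ _)) (≐-refl _) (⊃E (∧E₂ (⊢-wk₁ h₀)) h₀)))))))

pairᵅ : ∀ σ τ → Expr [] ((σ ⇒ τ ⇒ σ ⊗ τ) ⁺)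
pairᵅ σ τ = mkFun σ (τ ⇒ σ ⊗ τ) (pairWithᴱ σ τ) (fstᴱ (fstᴱ (sndᴱ v0)))

-- Dually, a witness for app_{σ⊗τ}(⟨x,y⟩, ⟨x',y⟩) cannot select the second component.
dom-pair : ∀ σ τ → HA⊢ {[]} (dom (σ ⇒ τ ⇒ σ ⊗ τ) (eval (pairᵅ σ τ) noSub))
dom-pair σ τ = dom-mkFun σ (τ ⇒ σ ⊗ τ) (pairWithᴱ σ τ) (fstᴱ (fstᴱ (sndᴱ v0))) noSub
  (⊢-theorem (dom-pairWith σ τ))
  (⊃I (⊃I (⊃I (∨E (≐zero-dec (sndT (sndT #0)))
    (app-resp-≐ σ (≐-fst (pairWith-ap σ τ _ _) ∙ ax (ax-fst _ _))
                  (≐-fst (pairWith-ap σ τ _ _) ∙ ax (ax-fst _ _)) (≐-refl _)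
                  (⊃E (∧E₁ (∧E₂ (⊢-wk₁ h₀))) h₀))
    (⊥E (app-irrefl τ (≐-snd (pairWith-ap σ τ _ _) ∙ ax (ax-snd _ _)
                       ∙ ≐-sym (≐-snd (pairWith-ap σ τ _ _) ∙ ax (ax-snd _ _)))
                      (⊃E (∧E₂ (∧E₂ (⊢-wk₁ h₀))) h₀)))))))

pair-ap : ∀ σ τ → HA⊢ {τ ⁺ ∷ σ ⁺ ∷ []}
  (ap τ (σ ⊗ τ) (ap σ (τ ⇒ σ ⊗ τ) (emb (eval (pairᵅ σ τ) noSub)) #1) #0 ≐ pairT #1 #0)
pair-ap σ τ = ≐-congˡ #0 (≐-fst (emb-mkFun-ap σ (τ ⇒ σ ⊗ τ) (pairWithᴱ σ τ) (fstᴱ (fstᴱ (sndᴱ v0))) #1))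
            ∙ pairWith-ap σ τ (ext noSub #1) #0

fstᵅ : ∀ σ τ → Expr [] ((σ ⊗ τ ⇒ σ) ⁺)
fstᵅ σ τ = mkFun (σ ⊗ τ) σ (fstᴱ v0) (pairᴱ (pairᴱ v0 (dummy⁻ τ)) (cn zero))

dom-fst : ∀ σ τ → HA⊢ {[]} (dom (σ ⊗ τ ⇒ σ) (eval (fstᵅ σ τ) noSub))
dom-fst σ τ = dom-mkFun (σ ⊗ τ) σ (fstᴱ v0) (pairᴱ (pairᴱ v0 (dummy⁻ τ)) (cn zero)) noSub
  (⊃I (∧E₁ h₀))
  (⊃I (⊃I (⊃I (∧I
    (⊃I (app-resp-≐ σ (≐-refl _) (≐-refl _) (≐-sym (≐-fst (ax (ax-fst _ _)) ∙ ax (ax-fst _ _))) (⊢-wk₁ h₀)))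
    (⊃I (⊥E (⊃E h₀ (ax (ax-snd _ _)))))))))

fst-pair : ∀ σ τ → HA⊢ {τ ⁺ ∷ σ ⁺ ∷ []} (ap (σ ⊗ τ) σ (emb (eval (fstᵅ σ τ) noSub))
  (ap τ (σ ⊗ τ) (ap σ (τ ⇒ σ ⊗ τ) (emb (eval (pairᵅ σ τ) noSub)) #1) #0) ≐ #1)
fst-pair σ τ = ≐-congʳ _ (pair-ap σ τ)
  ∙ emb-mkFun-ap (σ ⊗ τ) σ (fstᴱ v0) (pairᴱ (pairᴱ v0 (dummy⁻ τ)) (cn zero)) _ ∙ ax (ax-fst _ _)

sndᵅ : ∀ σ τ → Expr [] ((σ ⊗ τ ⇒ τ) ⁺)
sndᵅ σ τ = mkFun (σ ⊗ τ) τ (sndᴱ v0) (pairᴱ (pairᴱ (dummy⁻ σ) v0) (cn suc ⊙ cn zero))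

dom-snd : ∀ σ τ → HA⊢ {[]} (dom (σ ⊗ τ ⇒ τ) (eval (sndᵅ σ τ) noSub))
dom-snd σ τ = dom-mkFun (σ ⊗ τ) τ (sndᴱ v0) (pairᴱ (pairᴱ (dummy⁻ σ) v0) (cn suc ⊙ cn zero)) noSub
  (⊃I (∧E₂ h₀))
  (⊃I (⊃I (⊃I (∧I
    (⊃I (⊥E (⊃E (ax (ax-S≠0 (con zero))) (≐-sym (ax (ax-snd _ _)) ∙ h₀))))
    (⊃I (app-resp-≐ τ (≐-refl _) (≐-refl _) (≐-sym (≐-snd (ax (ax-fst _ _)) ∙ ax (ax-snd _ _))) (⊢-wk₁ h₀)))))))

snd-pair : ∀ σ τ → HA⊢ {τ ⁺ ∷ σ ⁺ ∷ []} (ap (σ ⊗ τ) τ (emb (eval (sndᵅ σ τ) noSub))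
  (ap τ (σ ⊗ τ) (ap σ (τ ⇒ σ ⊗ τ) (emb (eval (pairᵅ σ τ) noSub)) #1) #0) ≐ #0)
snd-pair σ τ = ≐-congʳ _ (pair-ap σ τ)
  ∙ emb-mkFun-ap (σ ⊗ τ) τ (sndᴱ v0) (pairᴱ (pairᴱ (dummy⁻ σ) v0) (cn suc ⊙ cn zero)) _ ∙ ax (ax-snd _ _)

-- Definition by cases and equality on type 0

ifzᴱ : ∀ {Θ σ} → Expr Θ ι → Expr Θ σ → Expr Θ σ → Expr Θ σ
ifzᴱ {σ = σ} n x y = cn (rec σ) ⊙ x ⊙ (cn (k _ ι) ⊙ (cn (k σ σ) ⊙ y)) ⊙ n

ifzT : ∀ {Γ σ} → Tm Γ ι → Tm Γ σ → Tm Γ σ → Tm Γ σ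
ifzT {σ = σ} n x y = con (rec σ) · x · (con (k _ ι) · (con (k σ σ) · y)) · n

module _ {Γ : Ctx} {Δ : List (Fm Γ)} {σ : Ty} {n : Tm Γ ι} where

  ifz-zero : {x y : Tm Γ σ} → Δ ⊢ n ≐ con zero → Δ ⊢ ifzT n x y ≐ x
  ifz-zero p = ≐-congʳ _ p ∙ ax (ax-R0 _ _)

  ifz-nonzero : {x y : Tm Γ σ} → Δ ⊢ ¬' (n ≐ con zero) → Δ ⊢ ifzT n x y ≐ y
  ifz-nonzero {x} {y} p = ⊃E (cast E (⊢-theorem (∀E (induction φ
      (⊃I (⊥E (⊃E h₀ (≐-refl _))))
      (∀I (⊃I (⊃I (ax (ax-RS _ _ _) ∙ ≐-congˡ _ (ax (ax-k _ _)) ∙ ax (ax-k _ _)))))) n))) p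
    where
    φ : Fm (ι ∷ Γ)
    φ = ¬' (#0 ≐ con zero) ⊃ ifzT #0 (wkT x) (wkT y) ≐ wkT y
    E : φ [ n ] ≡ (¬' (n ≐ con zero) ⊃ ifzT n x y ≐ y)
    E = cong₂ (λ a b → ¬' (n ≐ con zero) ⊃ ifzT n a b ≐ b) (subT-sub0S-wkT n x) (subT-sub0S-wkT n y)

  ifz-congᵗ : {x x' y : Tm Γ σ} → Δ ⊢ x ≐ x' → Δ ⊢ ifzT n x y ≐ ifzT n x' y
  ifz-congᵗ p = ≐-congˡ n (≐-congˡ _ (≐-congʳ _ p))

isZeroᴱ : ∀ {Θ} → Expr Θ (ι ⇒ ι)
isZeroᴱ = abs (cn (rec ι) ⊙ (cn suc ⊙ cn zero) ⊙ abs (abs (cn zero)) ⊙ v0)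

eqStepᴱ : ∀ {Θ} → Expr Θ (ι ⇒ (ι ⇒ ι) ⇒ (ι ⇒ ι))
eqStepᴱ = abs (abs (abs (cn (rec ι) ⊙ cn zero ⊙ abs (abs (v3 ⊙ v1)) ⊙ v0)))

-- eqT a c is 1 if a ≐ c and 0 otherwise.
eqᴱ : Expr [] (ι ⇒ ι ⇒ ι)
eqᴱ = cn (rec (ι ⇒ ι)) ⊙ isZeroᴱ ⊙ eqStepᴱ

eqT : ∀ {Γ} → Tm Γ (ι ⇒ ι ⇒ ι)
eqT = eval eqᴱ noSub

module _ {Γ : Ctx} {Δ : List (Fm Γ)} where

  eqT-0-· : (c : Tm Γ ι) →
            Δ ⊢ eqT · con zero · c ≐ con (rec ι) · (con suc · con zero) · eval (abs (abs (cn zero))) (ext noSub c) · c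
  eqT-0-· c = ≐-congˡ c (ax (ax-R0 _ _)) ∙ abs-β (cn (rec ι) ⊙ (cn suc ⊙ cn zero) ⊙ abs (abs (cn zero)) ⊙ v0) noSub c

  eqT-S-· : (a c : Tm Γ ι) → Δ ⊢ eqT · (con suc · a) · c
            ≐ con (rec ι) · con zero · eval (abs (abs (v3 ⊙ v1))) (ext (ext (ext noSub a) (eqT · a)) c) · c
  eqT-S-· a c = ≐-congˡ c (ax (ax-RS _ _ _))
              ∙ abs³-β (cn (rec ι) ⊙ cn zero ⊙ abs (abs (v3 ⊙ v1)) ⊙ v0) noSub a (eqT · a) c

  eqT-0-0 : Δ ⊢ eqT · con zero · con zero ≐ con suc · con zero
  eqT-0-0 = eqT-0-· (con zero) ∙ ax (ax-R0 _ _)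

  eqT-0-S : (c : Tm Γ ι) → Δ ⊢ eqT · con zero · (con suc · c) ≐ con zero
  eqT-0-S c = eqT-0-· (con suc · c) ∙ ax (ax-RS _ _ _)
            ∙ abs²-β {a = ι} {b = ι} (cn zero) (ext noSub (con suc · c)) c _

  eqT-S-0 : (a : Tm Γ ι) → Δ ⊢ eqT · (con suc · a) · con zero ≐ con zero
  eqT-S-0 a = eqT-S-· a (con zero) ∙ ax (ax-R0 _ _)

  eqT-S-S : (a c : Tm Γ ι) → Δ ⊢ eqT · (con suc · a) · (con suc · c) ≐ eqT · a · c
  eqT-S-S a c = eqT-S-· a (con suc · c) ∙ ax (ax-RS _ _ _)
              ∙ abs²-β (v3 ⊙ v1) (ext (ext (ext noSub a) (eqT · a)) (con suc · c)) c _

eqT-refl : ∀ {Γ} {Δ : List (Fm Γ)} (a : Tm Γ ι) → Δ ⊢ ¬' (eqT · a · a ≐ con zero)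
eqT-refl a = ⊢-theorem (∀E (induction (¬' (eqT · #0 · #0 ≐ con zero))
  (⊃I (⊃E (ax (ax-S≠0 (con zero))) (≐-sym eqT-0-0 ∙ h₀)))
  (∀I (⊃I (⊃I (⊃E h₁ (≐-sym (eqT-S-S #0 #0) ∙ h₀)))))) a)

eqT-nonzero⇒≐ : ∀ {Γ} {Δ : List (Fm Γ)} {a c : Tm Γ ι} → Δ ⊢ ¬' (eqT · a · c ≐ con zero) → Δ ⊢ a ≐ c
eqT-nonzero⇒≐ {a = a} {c} p = ⊃E (⊢-theorem (cast E (∀E (∀E by-induction a) c))) p
  where
  E : (¬' (eqT · wkT a · #0 ≐ con zero) ⊃ wkT a ≐ #0) [ c ] ≡ (¬' (eqT · a · c ≐ con zero) ⊃ a ≐ c)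
  E = cong (λ x → ¬' (eqT · x · c ≐ con zero) ⊃ x ≐ c) (subT-sub0S-wkT c a)
  by-induction : ∀ {Γ} → HA⊢ {Γ} (all ι (all ι (¬' (eqT · #1 · #0 ≐ con zero) ⊃ #1 ≐ #0)))
  by-induction = induction _
    (induction _ (⊃I (≐-refl _)) (∀I (⊃I (⊃I (⊥E (⊃E h₀ (eqT-0-S #0)))))))
    (∀I (⊃I (induction _ (⊃I (⊥E (⊃E h₀ (eqT-S-0 #0))))
      (∀I (⊃I (⊃I (≐-congʳ (con suc) (⊃E (∀E h₂ #0) (⊃I (⊃E h₁ (eqT-S-S #1 #0 ∙ h₀)))))))))))

-- app τ is an apartness: from app τ a b w and any c, either app τ a c w or app τ c b w.
-- discr makes the choice computable; it is 0 in the first case.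
discr⊗ᴱ : ∀ σ τ → Expr (((σ ⊗ τ) ⁻) ∷ ((σ ⊗ τ) ⁺) ∷ ((σ ⊗ τ) ⁺) ∷ []) ι
discr⇒ᴱ : ∀ σ τ → Expr (((σ ⇒ τ) ⁻) ∷ ((σ ⇒ τ) ⁺) ∷ ((σ ⇒ τ) ⁺) ∷ []) ι
discrᴱ : ∀ τ → Expr [] (τ ⁺ ⇒ τ ⁺ ⇒ τ ⁻ ⇒ ι)
discrᴱ ι = ƛ (ƛ (ƛ (cl eqᴱ ⊙ v2 ⊙ v1)))
discrᴱ (σ ⊗ τ) = ƛ (ƛ (ƛ (discr⊗ᴱ σ τ)))
discrᴱ (σ ⇒ τ) = ƛ (ƛ (ƛ (discr⇒ᴱ σ τ)))
discr⊗ᴱ σ τ = ifzᴱ (sndᴱ v0) (cl (discrᴱ σ) ⊙ fstᴱ v2 ⊙ fstᴱ v1 ⊙ fstᴱ (fstᴱ v0))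
                             (cl (discrᴱ τ) ⊙ sndᴱ v2 ⊙ sndᴱ v1 ⊙ sndᴱ (fstᴱ v0))
discr⇒ᴱ σ τ = cl (discrᴱ τ) ⊙ (fstᴱ v2 ⊙ fstᴱ v0) ⊙ (fstᴱ v1 ⊙ fstᴱ v0) ⊙ sndᴱ v0

discr : ∀ {Γ} τ → Tm Γ (τ ⁺) → Tm Γ (τ ⁺) → Tm Γ (τ ⁻) → Tm Γ ι
discr τ a c w = eval (discrᴱ τ) noSub · a · c · w

app-discr-zero : ∀ τ {Γ} {Δ : List (Fm Γ)} {a b c w} →
                 Δ ⊢ app τ a b w → Δ ⊢ discr τ a c w ≐ con zero → Δ ⊢ app τ a c w
app-discr-zero ι {a = a} {b} {c} {w} q d =
  ⊃I (⊃E (eqT-refl a) (≐-congʳ (eqT · a) h₀ ∙ ≐-sym (ƛ³-β (cl eqᴱ ⊙ v2 ⊙ v1) noSub a c w) ∙ ⊢-wk₁ d))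
app-discr-zero (σ ⊗ τ) {Γ} {Δ} {a} {b} {c} {w} q d = ∧I
  (⊃I (app-discr-zero σ (⊃E (⊢-wk₁ (∧E₁ q)) h₀) (≐-sym (ifz-zero h₀) ∙ unfold)))
  (⊃I (app-discr-zero τ (⊃E (⊢-wk₁ (∧E₂ q)) h₀) (≐-sym (ifz-nonzero h₀) ∙ unfold)))
  where
  unfold : ∀ {φ} → φ ∷ Δ ⊢ eval (discr⊗ᴱ σ τ) (ext (ext (ext noSub a) c) w) ≐ con zero
  unfold = ≐-sym (ƛ³-β (discr⊗ᴱ σ τ) noSub a c w) ∙ ⊢-wk₁ d
app-discr-zero (σ ⇒ τ) {a = a} {b} {c} {w} q d =
  ∧I (∧E₁ q) (app-discr-zero τ (∧E₂ q) (≐-sym (ƛ³-β (discr⇒ᴱ σ τ) noSub a c w) ∙ d))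

app-discr-nonzero : ∀ τ {Γ} {Δ : List (Fm Γ)} {a b c w} →
                    Δ ⊢ app τ a b w → Δ ⊢ ¬' (discr τ a c w ≐ con zero) → Δ ⊢ app τ c b w
app-discr-nonzero ι {a = a} {b} {c} {w} q d =
  ⊃I (⊃E (⊢-wk₁ q) (eqT-nonzero⇒≐ (⊃I (⊃E (⊢-wk₂ d) (ƛ³-β (cl eqᴱ ⊙ v2 ⊙ v1) noSub a c w ∙ h₀))) ∙ h₀))
app-discr-nonzero (σ ⊗ τ) {a = a} {b} {c} {w} q d = ∧I
  (⊃I (app-discr-nonzero σ (⊃E (⊢-wk₁ (∧E₁ q)) h₀)
         (⊃I (⊃E (⊢-wk₂ d) (ƛ³-β (discr⊗ᴱ σ τ) noSub a c w ∙ ifz-zero h₁ ∙ h₀)))))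
  (⊃I (app-discr-nonzero τ (⊃E (⊢-wk₁ (∧E₂ q)) h₀)
         (⊃I (⊃E (⊢-wk₂ d) (ƛ³-β (discr⊗ᴱ σ τ) noSub a c w ∙ ifz-nonzero h₁ ∙ h₀)))))
app-discr-nonzero (σ ⇒ τ) {a = a} {b} {c} {w} q d =
  ∧I (∧E₁ q) (app-discr-nonzero τ (∧E₂ q) (⊃I (⊃E (⊢-wk₁ d) (ƛ³-β (discr⇒ᴱ σ τ) noSub a c w ∙ h₀))))

-- s

apᴱ : ∀ {Θ} a b → Expr Θ ((a ⇒ b) ⁺) → Expr Θ (a ⁺) → Expr Θ (b ⁺)
apᴱ a b f u = cn (fst (a ⁺ ⇒ b ⁺) (a ⁺ ⇒ a ⁺ ⇒ b ⁻ ⇒ a ⁻)) ⊙ f ⊙ u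

backᴱ : ∀ {Θ} a b → Expr Θ ((a ⇒ b) ⁺) → Expr Θ (a ⁺) → Expr Θ (a ⁺) → Expr Θ (b ⁻) → Expr Θ (a ⁻)
backᴱ a b f u v w = cn (snd (a ⁺ ⇒ b ⁺) (a ⁺ ⇒ a ⁺ ⇒ b ⁻ ⇒ a ⁻)) ⊙ f ⊙ u ⊙ v ⊙ w

idSub₂ : ∀ {σ τ} → Sub (τ ∷ σ ∷ []) (τ ∷ σ ∷ [])
idSub₂ = ext (wkS idSub₁) #0

module S-Combinator (ρ σ τ : Ty) where

  X Y : Ty
  X = ρ ⇒ σ ⇒ τ
  Y = ρ ⇒ σ

  fwd₃ : Expr (ρ ⁺ ∷ Y ⁺ ∷ X ⁺ ∷ []) (τ ⁺)
  fwd₃ = apᴱ σ τ (apᴱ ρ (σ ⇒ τ) v2 v0) (apᴱ ρ σ v1 v0)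

  -- From a witness w for x z (y z) and x z' (y z'), split at x z' (y z): either x z and
  -- x z' are apart at (y z, w), pulled back by x; or x z' (y z) and x z' (y z') are
  -- apart at w, pulled back through x z' and then through y.
  back₃ : Expr (τ ⁻ ∷ ρ ⁺ ∷ ρ ⁺ ∷ Y ⁺ ∷ X ⁺ ∷ []) (ρ ⁻)
  back₃ = ifzᴱ (cl (discrᴱ τ) ⊙ x·z·yz ⊙ x·z'·yz ⊙ v0)
    (backᴱ ρ (σ ⇒ τ) v4 v2 v1 (pairᴱ (apᴱ ρ σ v3 v2) v0))
    (backᴱ ρ σ v3 v2 v1 (backᴱ σ τ (apᴱ ρ (σ ⇒ τ) v4 v1) (apᴱ ρ σ v3 v2) (apᴱ ρ σ v3 v1) v0))
    where
    x·z·yz x·z'·yz : Expr (τ ⁻ ∷ ρ ⁺ ∷ ρ ⁺ ∷ Y ⁺ ∷ X ⁺ ∷ []) (τ ⁺)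
    x·z·yz = apᴱ σ τ (apᴱ ρ (σ ⇒ τ) v4 v2) (apᴱ ρ σ v3 v2)
    x·z'·yz = apᴱ σ τ (apᴱ ρ (σ ⇒ τ) v4 v1) (apᴱ ρ σ v3 v2)

  fwd₂ : Expr (Y ⁺ ∷ X ⁺ ∷ []) ((ρ ⇒ τ) ⁺)
  fwd₂ = mkFun ρ τ fwd₃ back₃

  back₂ : Expr ((ρ ⇒ τ) ⁻ ∷ Y ⁺ ∷ Y ⁺ ∷ X ⁺ ∷ []) (Y ⁻)
  back₂ = pairᴱ (fstᴱ v0)
    (backᴱ σ τ (apᴱ ρ (σ ⇒ τ) v3 (fstᴱ v0)) (apᴱ ρ σ v2 (fstᴱ v0)) (apᴱ ρ σ v1 (fstᴱ v0)) (sndᴱ v0))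

  fwd₁ : Expr (X ⁺ ∷ []) ((Y ⇒ ρ ⇒ τ) ⁺)
  fwd₁ = mkFun Y (ρ ⇒ τ) fwd₂ back₂

  back₁ : Expr ((Y ⇒ ρ ⇒ τ) ⁻ ∷ X ⁺ ∷ X ⁺ ∷ []) (X ⁻)
  back₁ = pairᴱ (fstᴱ (sndᴱ v0)) (pairᴱ (apᴱ ρ σ (fstᴱ v0) (fstᴱ (sndᴱ v0))) (sndᴱ (sndᴱ v0)))

  sᵅ : Expr [] ((X ⇒ Y ⇒ ρ ⇒ τ) ⁺)
  sᵅ = mkFun X (Y ⇒ ρ ⇒ τ) fwd₁ back₁

  module _ {Γ : Ctx} {Δ : List (Fm Γ)} where

    back₃-sound : (θ : Sub (Y ⁺ ∷ X ⁺ ∷ []) Γ) (z z' : Tm Γ (ρ ⁺)) (w : Tm Γ (τ ⁻)) →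
      Δ ⊢ dom X (θ (vs vz)) → Δ ⊢ dom Y (θ vz) → Δ ⊢ dom ρ z → Δ ⊢ dom ρ z' →
      Δ ⊢ app τ (eval fwd₃ (ext θ z)) (eval fwd₃ (ext θ z')) w →
      Δ ⊢ app ρ z z' (eval back₃ (ext (ext (ext θ z) z') w))
    back₃-sound θ z z' w dx dy dz dz' a = ∨E (≐zero-dec (discr τ _ _ w))
      (app-resp-≐ ρ (≐-refl _) (≐-refl _) (≐-sym (ifz-zero h₀))
        (dom-back ρ (σ ⇒ τ) (⊢-wk₁ dx) (⊢-wk₁ dz) (⊢-wk₁ dz')
          (app⇒-intro σ τ (dom-ap ρ σ (⊢-wk₁ dy) (⊢-wk₁ dz)) (app-discr-zero τ (⊢-wk₁ a) h₀))))
      (app-resp-≐ ρ (≐-refl _) (≐-refl _) (≐-sym (ifz-nonzero h₀))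
        (dom-back ρ σ (⊢-wk₁ dy) (⊢-wk₁ dz) (⊢-wk₁ dz')
          (dom-back σ τ (dom-ap ρ (σ ⇒ τ) (⊢-wk₁ dx) (⊢-wk₁ dz'))
                        (dom-ap ρ σ (⊢-wk₁ dy) (⊢-wk₁ dz)) (dom-ap ρ σ (⊢-wk₁ dy) (⊢-wk₁ dz'))
            (app-discr-nonzero τ (⊢-wk₁ a) h₀))))

    back₂-sound : (θ : Sub (X ⁺ ∷ []) Γ) (y y' : Tm Γ (Y ⁺)) (w : Tm Γ ((ρ ⇒ τ) ⁻)) →
      Δ ⊢ dom X (θ vz) → Δ ⊢ dom Y y → Δ ⊢ dom Y y' →
      Δ ⊢ app (ρ ⇒ τ) (eval fwd₂ (ext θ y)) (eval fwd₂ (ext θ y')) w →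
      Δ ⊢ app Y y y' (eval back₂ (ext (ext (ext θ y) y') w))
    back₂-sound θ y y' w dx dy dy' a = app⇒-intro ρ σ dz
        (dom-back σ τ (dom-ap ρ (σ ⇒ τ) dx dz) (dom-ap ρ σ dy dz) (dom-ap ρ σ dy' dz)
          (app-resp-≐ τ (mkFun-ap ρ τ fwd₃ back₃ (ext θ y) (fstT w))
                        (mkFun-ap ρ τ fwd₃ back₃ (ext θ y') (fstT w))
                        (≐-refl _) (∧E₂ a)))
      where
      dz : Δ ⊢ dom ρ (fstT w)
      dz = ∧E₁ a

    back₁-sound : (θ : Sub [] Γ) (x x' : Tm Γ (X ⁺)) (w : Tm Γ ((Y ⇒ ρ ⇒ τ) ⁻)) →
      Δ ⊢ app (Y ⇒ ρ ⇒ τ) (eval fwd₁ (ext θ x)) (eval fwd₁ (ext θ x')) w →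
      Δ ⊢ app X x x' (eval back₁ (ext (ext (ext θ x) x') w))
    back₁-sound θ x x' w a = app⇒-intro ρ (σ ⇒ τ) dz
      (app⇒-intro σ τ (dom-ap ρ σ dy dz) (app-resp-≐ τ (fwd₁-ap x) (fwd₁-ap x') (≐-refl _) (∧E₂ (∧E₂ a))))
      where
      dy : Δ ⊢ dom Y (fstT w)
      dy = ∧E₁ a
      dz : Δ ⊢ dom ρ (fstT (sndT w))
      dz = ∧E₁ (∧E₂ a)
      fwd₁-ap : ∀ u → Δ ⊢ ap ρ τ (ap Y (ρ ⇒ τ) (eval fwd₁ (ext θ u)) (fstT w)) (fstT (sndT w))
                        ≐ eval fwd₃ (ext (ext (ext θ u) (fstT w)) (fstT (sndT w)))
      fwd₁-ap u = ≐-congˡ (fstT (sndT w)) (≐-fst (mkFun-ap Y (ρ ⇒ τ) fwd₂ back₂ (ext θ u) (fstT w)))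
                ∙ mkFun-ap ρ τ fwd₃ back₃ (ext (ext θ u) (fstT w)) (fstT (sndT w))

  dom-s : HA⊢ {[]} (dom (X ⇒ Y ⇒ ρ ⇒ τ) (eval sᵅ noSub))
  dom-s = dom-mkFun X (Y ⇒ ρ ⇒ τ) fwd₁ back₁ noSub
    (⊃I (dom-mkFun Y (ρ ⇒ τ) fwd₂ back₂ idSub₁
       (⊃I (dom-mkFun ρ τ fwd₃ back₃ idSub₂
          (⊃I (dom-ap σ τ (dom-ap ρ (σ ⇒ τ) (dom-wkF² X h₂) h₀)
                          (dom-ap ρ σ (cast (renF-dom Y vs #0) h₁) h₀)))
          (⊃I (⊃I (⊃I (back₃-sound (wkS³ idSub₂) #2 #1 #0
               (cast (trans (cong (λ φ → wkF (wkF (wkF φ))) (renF-dom X vs #0)) (wkF³-dom X #1)) h₄)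
               (cast (wkF³-dom Y #0) h₃) h₂ h₁ h₀))))))
       (⊃I (⊃I (⊃I (back₂-sound (wkS³ idSub₁) #2 #1 #0 (cast (wkF³-dom X #0) h₃) h₂ h₁ h₀))))))
    (⊃I (⊃I (⊃I (back₁-sound (wkS³ noSub) #2 #1 #0 h₀))))

  s-β : HA⊢ {ρ ⁺ ∷ Y ⁺ ∷ X ⁺ ∷ []}
    (ap ρ τ (ap Y (ρ ⇒ τ) (ap X (Y ⇒ ρ ⇒ τ) (emb (eval sᵅ noSub)) #2) #1) #0
     ≐ ap σ τ (ap ρ (σ ⇒ τ) #2 #0) (ap ρ σ #1 #0))
  s-β = ≐-congˡ #0 (≐-fst (≐-congˡ #1 (≐-fst (emb-mkFun-ap X (Y ⇒ ρ ⇒ τ) fwd₁ back₁ #2))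
                          ∙ mkFun-ap Y (ρ ⇒ τ) fwd₂ back₂ (ext noSub #2) #1))
      ∙ mkFun-ap ρ τ fwd₃ back₃ (ext (ext noSub #2) #1) #0

-- The recursor

subT-liftS-sub0S-wkT² : ∀ {Γ σ a} (t : Tm Γ σ) (n : Tm Γ ι) → subT (liftS {τ = a} (sub0S n)) (wkT² t) ≡ wkT t
subT-liftS-sub0S-wkT² t n = trans (subT-liftS-wkT (sub0S n) (wkT t)) (cong wkT (subT-sub0S-wkT n t))

subT-liftS-stepS-wkT² : ∀ {Γ σ a} (t : Tm Γ σ) → subT (liftS {τ = a} stepS) (wkT² t) ≡ wkT² t
subT-liftS-stepS-wkT² t = trans (subT-liftS-wkT stepS (wkT t)) (cong wkT (subT-stepS-wkT t))

subT-sub0S-renT-wkT² : ∀ {Γ σ a} (t : Tm Γ σ) (u : Tm (a ∷ ι ∷ Γ) a) →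
                       subT (sub0S u) (renT (liftR vs) (wkT² t)) ≡ wkT² t
subT-sub0S-renT-wkT² t u = trans (cong (subT (sub0S u)) (renT-liftR-wkT vs (wkT t))) (subT-sub0S-wkT u (wkT² t))

subT-sub0S²-wkT² : ∀ {Γ σ a} (t : Tm Γ σ) (n : Tm Γ ι) (w : Tm Γ a) →
                   subT (sub0S w) (subT (liftS (sub0S n)) (wkT² t)) ≡ t
subT-sub0S²-wkT² t n w = trans (cong (subT (sub0S w)) (subT-liftS-sub0S-wkT² t n)) (subT-sub0S-wkT w t)

subT-sub0S-renT-closed : ∀ {Γ τ a} (M : Expr [] τ) (u : Tm (a ∷ ι ∷ Γ) a) →
                         subT (sub0S u) (renT (liftR vs) (eval M noSub)) ≡ eval M noSub
subT-sub0S-renT-closed M u = trans (cong (subT (sub0S u)) (renT-closed M _)) (subT-closed M _)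

subT-sub0S²-closed : ∀ {Γ τ a} (M : Expr [] τ) (n : Tm Γ ι) (w : Tm Γ a) →
                     subT (sub0S w) (subT (liftS (sub0S n)) (eval M noSub)) ≡ eval M noSub
subT-sub0S²-closed M n w = trans (cong (subT (sub0S w)) (subT-closed M _)) (subT-closed M _)

module Recursor (σ : Ty) where

  Step IterTy PullTy SearchTy : Ty
  Step = ι ⇒ σ ⇒ σ
  IterTy = σ ⁺ ⇒ Step ⁺ ⇒ ι ⇒ σ ⁺
  PullTy = σ ⁺ ⇒ σ ⁺ ⇒ Step ⁺ ⇒ ι ⇒ σ ⁻ ⇒ σ ⁻
  SearchTy = σ ⁺ ⇒ Step ⁺ ⇒ Step ⁺ ⇒ ι ⇒ σ ⁻ ⇒ Step ⁻

  stepᴱ : Expr [] (Step ⁺ ⇒ ι ⇒ σ ⁺ ⇒ σ ⁺)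
  stepᴱ = ƛ (ƛ (ƛ (apᴱ σ σ (apᴱ ι (σ ⇒ σ) v2 v1) v0)))

  iterBodyᴱ : Expr (ι ∷ Step ⁺ ∷ σ ⁺ ∷ []) (σ ⁺)
  iterBodyᴱ = cn (rec (σ ⁺)) ⊙ v2 ⊙ (cl stepᴱ ⊙ v1) ⊙ v0

  iterᴱ : Expr [] IterTy
  iterᴱ = ƛ (ƛ (ƛ iterBodyᴱ))

  iterT : ∀ {Γ} → Tm Γ (σ ⁺) → Tm Γ (Step ⁺) → Tm Γ ι → Tm Γ (σ ⁺)
  iterT x y n = eval iterᴱ noSub · x · y · n

  module _ {Γ : Ctx} {Δ : List (Fm Γ)} where

    iter-zero : (x : Tm Γ (σ ⁺)) (y : Tm Γ (Step ⁺)) → Δ ⊢ iterT x y (con zero) ≐ x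
    iter-zero x y = ƛ³-β iterBodyᴱ noSub x y (con zero) ∙ ax (ax-R0 _ _)

    iter-suc : (x : Tm Γ (σ ⁺)) (y : Tm Γ (Step ⁺)) (m : Tm Γ ι) →
               Δ ⊢ iterT x y (con suc · m) ≐ ap σ σ (ap ι (σ ⇒ σ) y m) (iterT x y m)
    iter-suc x y m = ƛ³-β iterBodyᴱ noSub x y (con suc · m) ∙ ax (ax-RS _ _ _)
      ∙ ƛ³-β (apᴱ σ σ (apᴱ ι (σ ⇒ σ) v2 v1) v0) noSub y m _
      ∙ ≐-congʳ _ (≐-sym (ƛ³-β iterBodyᴱ noSub x y m))

  dom-iter-∀ : ∀ {Γ} (x : Tm Γ (σ ⁺)) (y : Tm Γ (Step ⁺)) →
               HA⊢ (dom σ x ⊃ dom Step y ⊃ all ι (dom σ (iterT (wkT x) (wkT y) #0)))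
  dom-iter-∀ x y = ⊃I (⊃I (induction _
    (cast (sym (trans (subF-dom σ _ _) (cong₃ (λ c a b → dom σ (c · a · b · con zero))
                 (subT-closed iterᴱ _) (subT-sub0S-wkT _ x) (subT-sub0S-wkT _ y))))
       (dom-resp-≐ σ (≐-sym (iter-zero x y)) h₁))
    (∀I (⊃I (cast (sym (trans (subF-dom σ stepS _) (cong₃ (λ c a b → dom σ (c · a · b · (con suc · #0)))
                 (subT-closed iterᴱ _) (subT-stepS-wkT x) (subT-stepS-wkT y))))
       (dom-resp-≐ σ (≐-sym (iter-suc (wkT x) (wkT y) #0))
         (dom-ap σ σ (dom-ap ι (σ ⇒ σ) (cast (renF-dom Step vs y) h₁) ⊤-intro) h₀)))))))

  dom-iter : ∀ {Γ} {Δ : List (Fm Γ)} {x y} → Δ ⊢ dom σ x → Δ ⊢ dom Step y → (n : Tm Γ ι) →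
             Δ ⊢ dom σ (iterT x y n)
  dom-iter {x = x} {y} dx dy n =
    cast (trans (subF-dom σ _ _) (cong₃ (λ c a b → dom σ (c · a · b · n))
           (subT-closed iterᴱ _) (subT-sub0S-wkT n x) (subT-sub0S-wkT n y)))
         (∀E (⊃E (⊃E (⊢-theorem (dom-iter-∀ x y)) dx) dy) n)

  -- pullT x x' y n pulls a witness for the n-th iterates back to x and x', one application
  -- of y (and its backward map) at a time.
  pullStepᴱ : Expr (σ ⁻ ∷ (σ ⁻ ⇒ σ ⁻) ∷ ι ∷ Step ⁺ ∷ σ ⁺ ∷ σ ⁺ ∷ []) (σ ⁻)
  pullStepᴱ = v1 ⊙ backᴱ σ σ (apᴱ ι (σ ⇒ σ) v3 v2) (cl iterᴱ ⊙ v5 ⊙ v3 ⊙ v2) (cl iterᴱ ⊙ v4 ⊙ v3 ⊙ v2) v0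

  pullBodyᴱ : Expr (Step ⁺ ∷ σ ⁺ ∷ σ ⁺ ∷ []) (ι ⇒ σ ⁻ ⇒ σ ⁻)
  pullBodyᴱ = cn (rec (σ ⁻ ⇒ σ ⁻)) ⊙ ƛ v0 ⊙ ƛ (ƛ (ƛ pullStepᴱ))

  pullᴱ : Expr [] PullTy
  pullᴱ = ƛ (ƛ (ƛ pullBodyᴱ))

  pullT : ∀ {Γ} → Tm Γ (σ ⁺) → Tm Γ (σ ⁺) → Tm Γ (Step ⁺) → Tm Γ ι → Tm Γ (σ ⁻) → Tm Γ (σ ⁻)
  pullT x x' y n w = eval pullᴱ noSub · x · x' · y · n · w

  pullOneT : ∀ {Γ} → Tm Γ (σ ⁺) → Tm Γ (σ ⁺) → Tm Γ (Step ⁺) → Tm Γ ι → Tm Γ (σ ⁻) → Tm Γ (σ ⁻)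
  pullOneT x x' y m w = sndT (ap ι (σ ⇒ σ) y m) · iterT x y m · iterT x' y m · w

  module _ {Γ : Ctx} {Δ : List (Fm Γ)} where

    pull-zero : ∀ x x' y (w : Tm Γ (σ ⁻)) → Δ ⊢ pullT x x' y (con zero) w ≐ w
    pull-zero x x' y w =
      ≐-congˡ w (≐-congˡ (con zero) (ƛ³-β pullBodyᴱ noSub x x' y) ∙ ax (ax-R0 _ _)) ∙ ƛ-β v0 _ w

    pull-suc : ∀ x x' y m (w : Tm Γ (σ ⁻)) →
               Δ ⊢ pullT x x' y (con suc · m) w ≐ pullT x x' y m (pullOneT x x' y m w)
    pull-suc x x' y m w =
      ≐-congˡ w (≐-congˡ (con suc · m) (ƛ³-β pullBodyᴱ noSub x x' y) ∙ ax (ax-RS _ _ _))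
      ∙ ƛ³-β pullStepᴱ (ext (ext (ext noSub x) x') y) m _ w
      ∙ ≐-sym (≐-congˡ (pullOneT x x' y m w) (≐-congˡ m (ƛ³-β pullBodyᴱ noSub x x' y)))

  PullSpec : ∀ {Γ} → Tm Γ IterTy → Tm Γ PullTy → Tm Γ (σ ⁺) → Tm Γ (σ ⁺) → Tm Γ (Step ⁺) →
             Tm Γ ι → Tm Γ (σ ⁻) → Fm Γ
  PullSpec r h x x' y n w = app σ (r · x · y · n) (r · x' · y · n) w ⊃ app σ x x' (h · x · x' · y · n · w)

  subF-PullSpec : ∀ {Γ Δ} (θ : Sub Γ Δ) r h x x' y n w → subF θ (PullSpec r h x x' y n w)
    ≡ PullSpec (subT θ r) (subT θ h) (subT θ x) (subT θ x') (subT θ y) (subT θ n) (subT θ w)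
  subF-PullSpec θ r h x x' y n w = cong₂ _⊃_ (subF-app σ θ _ _ _) (subF-app σ θ _ _ _)

  renF-PullSpec : ∀ {Γ Δ} (ρ : Ren Γ Δ) r h x x' y n w → renF ρ (PullSpec r h x x' y n w)
    ≡ PullSpec (renT ρ r) (renT ρ h) (renT ρ x) (renT ρ x') (renT ρ y) (renT ρ n) (renT ρ w)
  renF-PullSpec ρ r h x x' y n w = cong₂ _⊃_ (renF-app σ ρ _ _ _) (renF-app σ ρ _ _ _)

  PullSpec-cong : ∀ {Γ} {r r' h h' x x₁ x' x₁' y y₁ n n₁ w w₁} → r ≡ r' → h ≡ h' → x ≡ x₁ → x' ≡ x₁' →
                  y ≡ y₁ → n ≡ n₁ → w ≡ w₁ → PullSpec {Γ} r h x x' y n w ≡ PullSpec r' h' x₁ x₁' y₁ n₁ w₁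
  PullSpec-cong refl refl refl refl refl refl refl = refl

  pull-sound-∀ : ∀ {Γ} (x x' : Tm Γ (σ ⁺)) (y : Tm Γ (Step ⁺)) →
    HA⊢ (dom σ x ⊃ dom σ x' ⊃ dom Step y ⊃ all ι (all (σ ⁻)
      (PullSpec (eval iterᴱ noSub) (eval pullᴱ noSub) (wkT² x) (wkT² x') (wkT² y) #1 #0)))
  pull-sound-∀ x x' y = ⊃I (⊃I (⊃I (induction _
    (cast (sym (cong (all _) (trans (subF-PullSpec _ _ _ _ _ _ _ _)
        (PullSpec-cong (subT-closed iterᴱ _) (subT-closed pullᴱ _) (subT-liftS-sub0S-wkT² x _)
                       (subT-liftS-sub0S-wkT² x' _) (subT-liftS-sub0S-wkT² y _) refl refl))))
      (∀I (⊃I (app-resp-≐ σ (iter-zero _ _) (iter-zero _ _) (≐-sym (pull-zero _ _ _ _)) h₀))))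
    (∀I (⊃I (cast (sym (cong (all _) (trans (subF-PullSpec _ _ _ _ _ _ _ _)
        (PullSpec-cong (subT-closed iterᴱ _) (subT-closed pullᴱ _) (subT-liftS-stepS-wkT² x)
                       (subT-liftS-stepS-wkT² x') (subT-liftS-stepS-wkT² y) refl refl))))
      (∀I (⊃I
        (app-resp-≐ σ (≐-refl _) (≐-refl _) (≐-sym (pull-suc (wkT² x) (wkT² x') (wkT² y) #1 #0))
          (⊃E (cast (trans (cong (subF _) (renF-PullSpec _ _ _ _ _ _ _ _)) (trans (subF-PullSpec _ _ _ _ _ _ _ _)
                 (PullSpec-cong (subT-sub0S-renT-closed iterᴱ _) (subT-sub0S-renT-closed pullᴱ _)
                   (subT-sub0S-renT-wkT² x _) (subT-sub0S-renT-wkT² x' _) (subT-sub0S-renT-wkT² y _) refl refl)))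
                 (∀E h₁ (pullOneT (wkT² x) (wkT² x') (wkT² y) #1 #0)))
            (dom-back σ σ (dom-ap ι (σ ⇒ σ) (dom-wkF² Step h₂) ⊤-intro)
                          (dom-iter (dom-wkF² σ h₄) (dom-wkF² Step h₂) #1)
                          (dom-iter (dom-wkF² σ h₃) (dom-wkF² Step h₂) #1)
              (app-resp-≐ σ (iter-suc _ _ #1) (iter-suc _ _ #1) (≐-refl _) h₀))))))))))))

  pull-sound : ∀ {Γ} {Δ : List (Fm Γ)} {x x' y} → Δ ⊢ dom σ x → Δ ⊢ dom σ x' → Δ ⊢ dom Step y →
               (n : Tm Γ ι) (w : Tm Γ (σ ⁻)) →
               Δ ⊢ app σ (iterT x y n) (iterT x' y n) w → Δ ⊢ app σ x x' (pullT x x' y n w)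
  pull-sound {x = x} {x'} {y} dx dx' dy n w a = ⊃E (cast
    (trans (cong (subF _) (subF-PullSpec _ _ _ _ _ _ _ _)) (trans (subF-PullSpec _ _ _ _ _ _ _ _)
       (PullSpec-cong (subT-sub0S²-closed iterᴱ n w) (subT-sub0S²-closed pullᴱ n w) (subT-sub0S²-wkT² x n w)
                      (subT-sub0S²-wkT² x' n w) (subT-sub0S²-wkT² y n w) (subT-sub0S-wkT w n) refl)))
    (∀E (∀E (⊃E (⊃E (⊃E (⊢-theorem (pull-sound-∀ x x' y)) dx) dx') dy) n) w)) a

  -- searchT x y y' n w walks down from step n, splitting at y m (iterT x y' m) with the
  -- discriminator, until it finds a step m at which y m and y' m are apart.
  searchStepᴱ : Expr (σ ⁻ ∷ (σ ⁻ ⇒ Step ⁻) ∷ ι ∷ Step ⁺ ∷ Step ⁺ ∷ σ ⁺ ∷ []) (Step ⁻)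
  searchStepᴱ = ifzᴱ (cl (discrᴱ σ) ⊙ y·iterY ⊙ y·iterY' ⊙ v0)
    (v1 ⊙ backᴱ σ σ (apᴱ ι (σ ⇒ σ) v4 v2) iterY iterY' v0)
    (pairᴱ v2 (pairᴱ iterY' v0))
    where
    iterY iterY' y·iterY y·iterY' : Expr (σ ⁻ ∷ (σ ⁻ ⇒ Step ⁻) ∷ ι ∷ Step ⁺ ∷ Step ⁺ ∷ σ ⁺ ∷ []) (σ ⁺)
    iterY = cl iterᴱ ⊙ v5 ⊙ v4 ⊙ v2
    iterY' = cl iterᴱ ⊙ v5 ⊙ v3 ⊙ v2
    y·iterY = apᴱ σ σ (apᴱ ι (σ ⇒ σ) v4 v2) iterY
    y·iterY' = apᴱ σ σ (apᴱ ι (σ ⇒ σ) v4 v2) iterY'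

  searchBodyᴱ : Expr (Step ⁺ ∷ Step ⁺ ∷ σ ⁺ ∷ []) (ι ⇒ σ ⁻ ⇒ Step ⁻)
  searchBodyᴱ = cn (rec (σ ⁻ ⇒ Step ⁻)) ⊙ ƛ (pairᴱ (cn zero) (pairᴱ v3 v0)) ⊙ ƛ (ƛ (ƛ searchStepᴱ))

  searchᴱ : Expr [] SearchTy
  searchᴱ = ƛ (ƛ (ƛ searchBodyᴱ))

  searchT : ∀ {Γ} → Tm Γ (σ ⁺) → Tm Γ (Step ⁺) → Tm Γ (Step ⁺) → Tm Γ ι → Tm Γ (σ ⁻) → Tm Γ (Step ⁻)
  searchT x y y' n w = eval searchᴱ noSub · x · y · y' · n · w

  searchOneT : ∀ {Γ} → Tm Γ (σ ⁺) → Tm Γ (Step ⁺) → Tm Γ (Step ⁺) → Tm Γ ι → Tm Γ (σ ⁻) → Tm Γ (σ ⁻)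
  searchOneT x y y' m w = sndT (ap ι (σ ⇒ σ) y m) · iterT x y m · iterT x y' m · w

  search-suc : ∀ {Γ} {Δ : List (Fm Γ)} x y y' m (w : Tm Γ (σ ⁻)) → Δ ⊢ searchT x y y' (con suc · m) w ≐
    ifzT (discr σ (ap σ σ (ap ι (σ ⇒ σ) y m) (iterT x y m)) (ap σ σ (ap ι (σ ⇒ σ) y m) (iterT x y' m)) w)
         (searchT x y y' m (searchOneT x y y' m w)) (pairT m (pairT (iterT x y' m) w))
  search-suc x y y' m w = ≐-congˡ w (≐-congˡ (con suc · m) (ƛ³-β searchBodyᴱ noSub x y y') ∙ ax (ax-RS _ _ _))
    ∙ ƛ³-β searchStepᴱ (ext (ext (ext noSub x) y) y') m _ w
    ∙ ifz-congᵗ (≐-sym (≐-congˡ (searchOneT x y y' m w) (≐-congˡ m (ƛ³-β searchBodyᴱ noSub x y y'))))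

  SearchSpec : ∀ {Γ} → Tm Γ IterTy → Tm Γ SearchTy → Tm Γ (σ ⁺) → Tm Γ (Step ⁺) → Tm Γ (Step ⁺) →
               Tm Γ ι → Tm Γ (σ ⁻) → Fm Γ
  SearchSpec r sr x y y' n w = app σ (r · x · y · n) (r · x · y' · n) w ⊃ app Step y y' (sr · x · y · y' · n · w)

  subF-SearchSpec : ∀ {Γ Δ} (θ : Sub Γ Δ) r sr x y y' n w → subF θ (SearchSpec r sr x y y' n w)
    ≡ SearchSpec (subT θ r) (subT θ sr) (subT θ x) (subT θ y) (subT θ y') (subT θ n) (subT θ w)
  subF-SearchSpec θ r sr x y y' n w = cong₂ _⊃_ (subF-app σ θ _ _ _) (subF-app Step θ _ _ _)

  renF-SearchSpec : ∀ {Γ Δ} (ρ : Ren Γ Δ) r sr x y y' n w → renF ρ (SearchSpec r sr x y y' n w)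
    ≡ SearchSpec (renT ρ r) (renT ρ sr) (renT ρ x) (renT ρ y) (renT ρ y') (renT ρ n) (renT ρ w)
  renF-SearchSpec ρ r sr x y y' n w = cong₂ _⊃_ (renF-app σ ρ _ _ _) (renF-app Step ρ _ _ _)

  SearchSpec-cong : ∀ {Γ} {r r' sr sr' x x₁ y y₁ y' y₁' n n₁ w w₁} → r ≡ r' → sr ≡ sr' → x ≡ x₁ →
                    y ≡ y₁ → y' ≡ y₁' → n ≡ n₁ → w ≡ w₁ →
                    SearchSpec {Γ} r sr x y y' n w ≡ SearchSpec r' sr' x₁ y₁ y₁' n₁ w₁
  SearchSpec-cong refl refl refl refl refl refl refl = refl

  -- At n = 0 the hypothesis app σ x x w is refutable, so the base value of the search is
  -- arbitrary.
  search-sound-∀ : ∀ {Γ} (x : Tm Γ (σ ⁺)) (y y' : Tm Γ (Step ⁺)) →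
    HA⊢ (dom σ x ⊃ dom Step y ⊃ dom Step y' ⊃ all ι (all (σ ⁻)
      (SearchSpec (eval iterᴱ noSub) (eval searchᴱ noSub) (wkT² x) (wkT² y) (wkT² y') #1 #0)))
  search-sound-∀ {Γ} x y y' = ⊃I (⊃I (⊃I (induction _
    (cast (sym (cong (all _) (trans (subF-SearchSpec _ _ _ _ _ _ _ _)
        (SearchSpec-cong (subT-closed iterᴱ _) (subT-closed searchᴱ _) (subT-liftS-sub0S-wkT² x _)
                         (subT-liftS-sub0S-wkT² y _) (subT-liftS-sub0S-wkT² y' _) refl refl))))
      (∀I (⊃I (⊥E (app-irrefl σ (iter-zero _ _ ∙ ≐-sym (iter-zero _ _)) h₀)))))
    (∀I (⊃I (cast (sym (cong (all _) (trans (subF-SearchSpec _ _ _ _ _ _ _ _)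
        (SearchSpec-cong (subT-closed iterᴱ _) (subT-closed searchᴱ _) (subT-liftS-stepS-wkT² x)
                         (subT-liftS-stepS-wkT² y) (subT-liftS-stepS-wkT² y') refl refl))))
      (∀I (⊃I (app-resp-≐ Step (≐-refl _) (≐-refl _) (≐-sym (search-suc X Y Y' #1 #0))
        (∨E (≐zero-dec (discr σ y·iterY y·iterY' #0))
          (app-resp-≐ Step (≐-refl _) (≐-refl _) (≐-sym (ifz-zero h₀))
            (⊃E (cast (trans (cong (subF _) (renF-SearchSpec _ _ _ _ _ _ _ _)) (trans (subF-SearchSpec _ _ _ _ _ _ _ _)
                   (SearchSpec-cong (subT-sub0S-renT-closed iterᴱ _) (subT-sub0S-renT-closed searchᴱ _)
                     (subT-sub0S-renT-wkT² x _) (subT-sub0S-renT-wkT² y _) (subT-sub0S-renT-wkT² y' _) refl refl)))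
                   (∀E h₂ (searchOneT X Y Y' #1 #0)))
              (dom-back σ σ (dom-ap ι (σ ⇒ σ) (⊢-wk₁ (dom-wkF² Step h₃)) ⊤-intro)
                            (dom-iter (⊢-wk₁ (dom-wkF² σ h₄)) (⊢-wk₁ (dom-wkF² Step h₃)) #1)
                            (dom-iter (⊢-wk₁ (dom-wkF² σ h₄)) (⊢-wk₁ (dom-wkF² Step h₂)) #1)
                (app-discr-zero σ (⊢-wk₁ (apart h₀)) h₀))))
          (app-resp-≐ Step (≐-refl _) (≐-refl _) (≐-sym (ifz-nonzero h₀))
            (app⇒-intro ι (σ ⇒ σ) ⊤-intro
              (app⇒-intro σ σ (dom-iter (⊢-wk₁ (dom-wkF² σ h₄)) (⊢-wk₁ (dom-wkF² Step h₂)) #1)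
                 (app-discr-nonzero σ (⊢-wk₁ (apart h₀)) h₀))))))))))))))
    where
    X : Tm (σ ⁻ ∷ ι ∷ Γ) (σ ⁺)
    X = wkT² x
    Y Y' : Tm (σ ⁻ ∷ ι ∷ Γ) (Step ⁺)
    Y = wkT² y
    Y' = wkT² y'
    y·iterY y·iterY' : Tm (σ ⁻ ∷ ι ∷ Γ) (σ ⁺)
    y·iterY = ap σ σ (ap ι (σ ⇒ σ) Y #1) (iterT X Y #1)
    y·iterY' = ap σ σ (ap ι (σ ⇒ σ) Y #1) (iterT X Y' #1)
    apart : ∀ {Δ'} → Δ' ⊢ app σ (iterT X Y (con suc · #1)) (iterT X Y' (con suc · #1)) #0 →
            Δ' ⊢ app σ y·iterY (ap σ σ (ap ι (σ ⇒ σ) Y' #1) (iterT X Y' #1)) #0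
    apart = app-resp-≐ σ (iter-suc X Y #1) (iter-suc X Y' #1) (≐-refl _)

  search-sound : ∀ {Γ} {Δ : List (Fm Γ)} {x y y'} → Δ ⊢ dom σ x → Δ ⊢ dom Step y → Δ ⊢ dom Step y' →
                 (n : Tm Γ ι) (w : Tm Γ (σ ⁻)) →
                 Δ ⊢ app σ (iterT x y n) (iterT x y' n) w → Δ ⊢ app Step y y' (searchT x y y' n w)
  search-sound {x = x} {y} {y'} dx dy dy' n w a = ⊃E (cast
    (trans (cong (subF _) (subF-SearchSpec _ _ _ _ _ _ _ _)) (trans (subF-SearchSpec _ _ _ _ _ _ _ _)
       (SearchSpec-cong (subT-sub0S²-closed iterᴱ n w) (subT-sub0S²-closed searchᴱ n w) (subT-sub0S²-wkT² x n w)
                        (subT-sub0S²-wkT² y n w) (subT-sub0S²-wkT² y' n w) (subT-sub0S-wkT w n) refl)))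
    (∀E (∀E (⊃E (⊃E (⊃E (⊢-theorem (search-sound-∀ x y y')) dx) dy) dy') n) w)) a

  fwd₃ : Expr (ι ∷ Step ⁺ ∷ σ ⁺ ∷ []) (σ ⁺)
  fwd₃ = cl iterᴱ ⊙ v2 ⊙ v1 ⊙ v0

  -- app ι ignores its witness, so the backward map in the number argument is arbitrary.
  fwd₂ : Expr (Step ⁺ ∷ σ ⁺ ∷ []) ((ι ⇒ σ) ⁺)
  fwd₂ = mkFun ι σ fwd₃ (cn zero)

  back₂ : Expr ((ι ⇒ σ) ⁻ ∷ Step ⁺ ∷ Step ⁺ ∷ σ ⁺ ∷ []) (Step ⁻)
  back₂ = cl searchᴱ ⊙ v3 ⊙ v2 ⊙ v1 ⊙ fstᴱ v0 ⊙ sndᴱ v0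

  fwd₁ : Expr (σ ⁺ ∷ []) ((Step ⇒ ι ⇒ σ) ⁺)
  fwd₁ = mkFun Step (ι ⇒ σ) fwd₂ back₂

  back₁ : Expr ((Step ⇒ ι ⇒ σ) ⁻ ∷ σ ⁺ ∷ σ ⁺ ∷ []) (σ ⁻)
  back₁ = cl pullᴱ ⊙ v2 ⊙ v1 ⊙ fstᴱ v0 ⊙ fstᴱ (sndᴱ v0) ⊙ sndᴱ (sndᴱ v0)

  recᵅ : Expr [] ((σ ⇒ Step ⇒ ι ⇒ σ) ⁺)
  recᵅ = mkFun σ (Step ⇒ ι ⇒ σ) fwd₁ back₁

  dom-rec : HA⊢ {[]} (dom (σ ⇒ Step ⇒ ι ⇒ σ) (eval recᵅ noSub))
  dom-rec = dom-mkFun σ (Step ⇒ ι ⇒ σ) fwd₁ back₁ noSub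
    (⊃I (dom-mkFun Step (ι ⇒ σ) fwd₂ back₂ idSub₁
      (⊃I (dom-mkFun ι σ fwd₃ (cn zero) idSub₂
        (⊃I (dom-iter (dom-wkF² σ h₂) (cast (renF-dom Step vs #0) h₁) #0))
        (⊃I (⊃I (⊃I (⊃I (app-irrefl σ (≐-congʳ _ h₀) h₁)))))))
      (⊃I (⊃I (⊃I (search-sound (cast (wkF³-dom σ #0) h₃) h₂ h₁ (fstT #0) (sndT #0)
        (app-resp-≐ σ (mkFun-ap ι σ fwd₃ (cn zero) (ext (wkS³ idSub₁) #2) (fstT #0))
                      (mkFun-ap ι σ fwd₃ (cn zero) (ext (wkS³ idSub₁) #1) (fstT #0))
                      (≐-refl _) (∧E₂ h₀))))))))
    (⊃I (⊃I (⊃I (pull-sound h₂ h₁ (∧E₁ h₀) (fstT (sndT #0)) (sndT (sndT #0))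
      (app-resp-≐ σ (fwd₁-ap #2) (fwd₁-ap #1) (≐-refl _) (∧E₂ (∧E₂ h₀)))))))
    where
    fwd₁-ap : ∀ {Δ} (x : Tm ((Step ⇒ ι ⇒ σ) ⁻ ∷ σ ⁺ ∷ σ ⁺ ∷ []) (σ ⁺)) →
              Δ ⊢ ap ι σ (ap Step (ι ⇒ σ) (eval fwd₁ (ext (wkS³ noSub) x)) (fstT #0)) (fstT (sndT #0))
                ≐ iterT x (fstT #0) (fstT (sndT #0))
    fwd₁-ap x = ≐-congˡ _ (≐-fst (mkFun-ap Step (ι ⇒ σ) fwd₂ back₂ (ext (wkS³ noSub) x) (fstT #0)))
              ∙ mkFun-ap ι σ fwd₃ (cn zero) (ext (ext (wkS³ noSub) x) (fstT #0)) (fstT (sndT #0))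

  rec⁺ : ∀ {Γ} → Tm Γ (σ ⁺) → Tm Γ (Step ⁺) → Tm Γ ((ι ⇒ σ) ⁺)
  rec⁺ x y = ap Step (ι ⇒ σ) (ap σ (Step ⇒ ι ⇒ σ) (emb (eval recᵅ noSub)) x) y

  rec⁺-ap : ∀ {Γ} {Δ : List (Fm Γ)} x y u → Δ ⊢ ap ι σ (rec⁺ x y) u ≐ iterT x y u
  rec⁺-ap x y u = ≐-congˡ u (≐-fst (≐-congˡ y (≐-fst (emb-mkFun-ap σ (Step ⇒ ι ⇒ σ) fwd₁ back₁ x))
                                   ∙ mkFun-ap Step (ι ⇒ σ) fwd₂ back₂ (ext noSub x) y))
                ∙ mkFun-ap ι σ fwd₃ (cn zero) (ext (ext noSub x) y) u

  rec-zero : HA⊢ {Step ⁺ ∷ σ ⁺ ∷ []} (ap ι σ (rec⁺ #1 #0) (con zero) ≐ #1)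
  rec-zero = rec⁺-ap #1 #0 (con zero) ∙ iter-zero #1 #0

  rec-suc : HA⊢ {ι ∷ Step ⁺ ∷ σ ⁺ ∷ []}
    (ap ι σ (rec⁺ #2 #1) (ap ι ι (emb (eval sucᵅ noSub)) #0)
     ≐ ap σ σ (ap ι (σ ⇒ σ) #1 #0) (ap ι σ (rec⁺ #2 #1) #0))
  rec-suc = ≐-congʳ _ (emb-mkFun-ap ι ι (cn suc ⊙ v0) (cn zero) #0) ∙ rec⁺-ap #2 #1 (con suc · #0)
          ∙ iter-suc #2 #1 #0 ∙ ≐-congʳ _ (≐-sym (rec⁺-ap #2 #1 #0))

open S-Combinator using (sᵅ; dom-s; s-β)
open Recursor using (recᵅ; dom-rec; rec-zero; rec-suc)

translationᴱ : ∀ {σ} → Const σ → Expr [] (σ ⁺)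
translationᴱ (k ρ σ) = kᵅ ρ σ
translationᴱ (s ρ σ τ) = sᵅ ρ σ τ
translationᴱ (pair σ τ) = pairᵅ σ τ
translationᴱ (fst σ τ) = fstᵅ σ τ
translationᴱ (snd σ τ) = sndᵅ σ τ
translationᴱ zero = cn zero
translationᴱ suc = sucᵅ
translationᴱ (rec σ) = recᵅ σ

translation : Translation
translation c = eval (translationᴱ c) noSub

dom-translation : ∀ {σ} (c : Const σ) → HA⊢ {[]} (dom σ (translation c))
dom-translation (k ρ σ) = dom-k ρ σ
dom-translation (s ρ σ τ) = dom-s ρ σ τ
dom-translation (pair σ τ) = dom-pair σ τ
dom-translation (fst σ τ) = dom-fst σ τ
dom-translation (snd σ τ) = dom-snd σ τ
dom-translation zero = ⊤-intro
dom-translation suc = dom-suc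
dom-translation (rec σ) = dom-rec σ

proposition5p2 : Σ Translation λ α →
    ((∀ {σ} (c : Const σ) → HA⊢ {[]} (dom σ (α c)))
    × (∀ ρ σ → EqK α ρ σ)
    × (∀ ρ σ τ → EqS α ρ σ τ)
    × (∀ σ τ → EqFst α σ τ)
    × (∀ σ τ → EqSnd α σ τ)
    × (∀ σ → EqR0 α σ)
    × (∀ σ → EqRS α σ))
proposition5p2 = translation , dom-translation , k-β , s-β , fst-pair , snd-pair , rec-zero , rec-suc
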